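{- For $1<i\le k$, \[ D_i^k(\boldsymbol{x}) = \frac{1}{1-x_1x_i}\bigg[D_{i-1}^k(\boldsymbol{x})+x_1x_i\big[D_{i-1}^k(\boldsymbol{x}) +D_{i-1}^{k-1}(\boldsymbol{x}; \hat{x}_i)+L^{k-2}(\boldsymbol{x}; \hat{x}_1, \hat{x}_i) + 2L^{k-1}(\boldsymbol{x}; \hat{x}_1)\big]\bigg]. \]
   Context: $\mathcal{S}_n$ is the set of permutations of $[n]$, in one-line notation $\pi=\pi_1\cdots\pi_n$. A sequence is unimodal if it is strictly increasing and then strictly decreasing. For a composition $\lambda=(\lambda_1,\ldots,\lambda_k)$ of $n$, $\pi\in\mathcal{S}_n$ is $\lambda$-unimodal if cutting its one-line notation into consecutive segments of lengths $\lambda_1,\ldots,\lambda_k$ gives unimodal segments. An involution is a permutation equal to its own inverse; $\mathcal{I}^\lambda$ is the set of $\lambda$-unimodal involutions. Let $s^i_\lambda=\lambda_1+\cdots+\lambda_i$. For $1\le i\le k$, $\mathcal{D}^\lambda_i$ is the set of $\pi\in\mathcal{I}^\lambda$ with $\pi_1\le s^i_\lambda$ and $\pi_1>\pi_2>\cdots>\pi_{\lambda_1}$. $\Lambda_m$ is the set of compositions with exactly $m$ parts; $\boldsymbol{x}=(x_1,\ldots,x_k)$ are indeterminates and $x^\lambda=\prod x_i^{\lambda_i}$. $L^m(\boldsymbol{x})=\sum_{\lambda\in\Lambda_m}|\mathcal{I}^\lambda|x^\lambda$ (with $L^0=1$) and $D^m_i(\boldsymbol{x})=\sum_{\lambda\in\Lambda_m}|\mathcal{D}^\lambda_i|x^\lambda$.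 For such a series $F$ in $k-r$ variables, $F(\boldsymbol{x};\hat x_{i_1},\ldots,\hat x_{i_r})$ denotes $F$ evaluated at $x_1,\ldots,x_k$ with $x_{i_1},\ldots,x_{i_r}$ deleted, in increasing order of index. -}

module Defs where

open import Data.Bool using (Bool; true; false; _∧_; if_then_else_)
open import Data.Nat using (ℕ; zero; suc; _+_; _*_; _∸_; _<ᵇ_; _≤ᵇ_; _≡ᵇ_)
open import Data.Fin using (Fin; toℕ) renaming (zero to fz; suc to fs)
import Data.Fin as F
open import Data.List using (List; []; _∷_; map; concatMap; filterᵇ; length; take; drop; upTo)
open import Data.Nat.ListAction using (sum)
open import Data.Vec using (Vec; lookup; toList; removeAt; updateAt; allFin)
import Data.Vec as V
open import Relation.Nullary.Decidable using (⌊_⌋)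
open import Relation.Binary.PropositionalEquality using (_≡_)

-- Permutations / involutions (one-line notation, values 0-based)

allᵇ : {A : Set} → (A → Bool) → List A → Bool
allᵇ p []       = true
allᵇ p (x ∷ xs) = p x ∧ allᵇ p xs

allVec : {A : Set} (m : ℕ) → List A → List (Vec A m)
allVec zero    xs = V.[] ∷ []
allVec (suc m) xs = concatMap (λ x → map (x V.∷_) (allVec m xs)) xs

-- π ∘ π = id (this forces π to be a bijection, i.e. an involution of [n])
isInvol : {n : ℕ} → Vec (Fin n) n → Bool
isInvol {n} v = allᵇ (λ j → ⌊ lookup v (lookup v j) F.≟ j ⌋) (toList (allFin n))

vals : {n : ℕ} → Vec (Fin n) n → List ℕ
vals v = toList (V.map toℕ v)

decr : List ℕ → Bool
decr (a ∷ b ∷ r) = (b <ᵇ a) ∧ decr (b ∷ r)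
decr _ = true

unimodal : List ℕ → Bool
unimodal (a ∷ b ∷ r) = if a <ᵇ b then unimodal (b ∷ r) else decr (a ∷ b ∷ r)
unimodal _ = true

segments : List ℕ → List ℕ → List (List ℕ)
segments xs []       = []
segments xs (l ∷ ls) = take l xs ∷ segments (drop l xs) ls

lamUnimodal : List ℕ → List ℕ → Bool
lamUnimodal lam xs = allᵇ unimodal (segments xs lam)

-- first entry (1-based value) ≤ s   (false on the empty sequence)
firstLe : ℕ → List ℕ → Bool
firstLe s []      = false
firstLe s (a ∷ _) = suc a ≤ᵇ s

headPart : List ℕ → ℕ
headPart []      = 0
headPart (l ∷ _) = l

countI : List ℕ → ℕ
countI lam = length (filterᵇ (λ v → isInvol v ∧ lamUnimodal lam (vals v))
                             (allVec (sum lam) (toList (allFin (sum lam)))))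

-- |D_i^λ| (i is 1-based): π ∈ I^λ, π_1 ≤ s^i_λ, π_1 > ... > π_{λ_1}
countD : ℕ → List ℕ → ℕ
countD i lam = length (filterᵇ
  (λ v → isInvol v ∧ lamUnimodal lam (vals v)
         ∧ firstLe (sum (take i lam)) (vals v)
         ∧ decr (take (headPart lam) (vals v)))
  (allVec (sum lam) (toList (allFin (sum lam)))))

-- Formal power series in k variables with ℕ coefficients:
-- a series is its coefficient function on exponent vectors.

Series : ℕ → Set
Series k = Vec ℕ k → ℕ

allPos : {k : ℕ} → Vec ℕ k → Bool
allPos μ = allᵇ (λ e → 1 ≤ᵇ e) (toList μ)

-- L^k(x) = Σ_{λ ∈ Λ_k} |I^λ| x^λ
L : (k : ℕ) → Series k
L k μ = if allPos μ then countI (toList μ) else 0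

-- D^k_i(x) = Σ_{λ ∈ Λ_k} |D^λ_i| x^λ   (i 1-based)
D : (k : ℕ) → ℕ → Series k
D k i μ = if allPos μ then countD i (toList μ) else 0

_⊕_ : {k : ℕ} → Series k → Series k → Series k
(F ⊕ G) μ = F μ + G μ

scale : {k : ℕ} → ℕ → Series k → Series k
scale c F μ = c * F μ

-- F(x; x̂_j): F in one variable fewer, variable at position j deleted
hat : {m : ℕ} → Fin (suc m) → Series m → Series (suc m)
hat j F μ = if lookup μ j ≡ᵇ 0 then F (removeAt μ j) else 0

shiftCoeff : {k : ℕ} → Fin k → Fin k → ℕ → Series k → Vec ℕ k → ℕ
shiftCoeff a b t F μ =
  if (t ≤ᵇ lookup μ a) ∧ (t ≤ᵇ lookup μ b)
  then F (updateAt (updateAt μ a (_∸ t)) b (_∸ t)) else 0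

-- multiplication by the monomial x_a x_b  (a ≠ b)
mulMono : {k : ℕ} → Fin k → Fin k → Series k → Series k
mulMono a b F μ = shiftCoeff a b 1 F μ

-- multiplication by 1/(1 - x_a x_b) = Σ_t (x_a x_b)^t  (a ≠ b)
divOneMinus : {k : ℕ} → Fin k → Fin k → Series k → Series k
divOneMinus a b F μ = sum (map (λ t → shiftCoeff a b t F μ) (upTo (suc (lookup μ a))))

_≈_ : {k : ℕ} → Series k → Series k → Set
F ≈ G = ∀ μ → F μ ≡ G μ

-- For λ = (λ₁, α, λᵢ, β) with |α| = i − 2, the difference D^λ_i − D^λ_{i−1} counts the π ∈ D^λ_i whose first
-- value π₁ falls into the i-th block of positions.  Since π is an involution, the value 1 sits at position π₁, and
-- as the minimum of a unimodal block it sits at one of its ends: π₁ = s^{i−1}_λ + 1 or π₁ = s^i_λ.  Deleting the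
-- 2-cycle (1 π₁) and standardising is a bijection onto the λ′-unimodal involutions σ, λ′ = (λ₁ − 1, α, λᵢ − 1, β),
-- whose first block decreases with σ₁ ≤ π₁ − 2, i.e. onto D^{λ′}_{i−1} resp. D^{λ′}_i.  The two ends coincide when
-- λᵢ = 1, the conditions on the first block disappear when λ₁ = 1, and zero parts of λ′ are dropped; this gives
--   D_i = D_{i−1} + x₁xᵢ (D_{i−1} + D^{k−1}_{i−1}(x̂ᵢ) + L^{k−2}(x̂₁, x̂ᵢ) + 2 L^{k−1}(x̂₁) + D_i),
-- and solving for D_i yields the claim.

module Submission where

open import Defs
open import Data.Nat using (ℕ; suc; _+_)
open import Data.Fin using (Fin; toℕ) renaming (zero to fz; suc to fs)

open import Data.Bool using (Bool; true; false; _∧_; not; if_then_else_; T; T?)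
open import Data.Bool.Properties using (∧-assoc; ∧-zeroʳ; ∧-identityʳ; ∧-conicalˡ; ∧-conicalʳ; T-≡; ⇔→≡)
open import Data.Empty using (⊥-elim)
import Data.Fin.Properties as F
open import Data.List using (List; []; _∷_; map; concatMap; filterᵇ; length; take; drop; upTo; applyUpTo; _++_; cartesianProductWith)
open import Data.List.Properties using (∷-injective; length-map; map-∘; map-id-local; map-++)
open import Data.List.Membership.Propositional using (_∈_)
open import Data.List.Membership.Propositional.Properties
  using (∈-∃++; ∈-++⁻; ∈-++⁺ˡ; ∈-++⁺ʳ; ∈-map⁻; ∈-filter⁻; ∈-upTo⁺; ∈-upTo⁻;
         ∈-cartesianProductWith⁺; ∈-cartesianProductWith⁻)
open import Data.List.Relation.Unary.All using (All) renaming (map to All-map)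
import Data.List.Relation.Unary.All as All
open import Data.List.Relation.Unary.AllPairs using ([]; _∷_)
open import Data.List.Relation.Unary.Any using (here; there)
open import Data.List.Relation.Unary.Unique.Propositional using (Unique)
import Data.List.Relation.Unary.Unique.Propositional.Properties as Unique
open import Data.Nat using (zero; _*_; _∸_; _<ᵇ_; _≤ᵇ_; _≡ᵇ_; _≤_; _<_; z≤n; s≤s; _≟_; _<?_)
open import Data.Nat.ListAction using (sum)
open import Data.Nat.ListAction.Properties using (sum-++)
open import Data.Nat.Properties
open import Data.Product using (Σ; _×_; _,_; proj₁; proj₂)
open import Data.Sum using (_⊎_; inj₁; inj₂; [_,_]′)
open import Data.Vec using (Vec; lookup; toList; removeAt; updateAt; allFin)
import Data.Vec as V
import Data.Vec.Properties as V
open import Function using (_∘_; case_of_; Equivalence; mk⇔)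
open import Relation.Binary.PropositionalEquality using (_≡_; _≢_; refl; sym; trans; cong; cong₂; subst; subst₂; module ≡-Reasoning)
open import Relation.Nullary.Decidable using (⌊_⌋; yes; no)
open import Relation.Nullary.Reflects using (Reflects; ofʸ; ofⁿ; fromEquivalence)

private variable
  A B : Set

T⇒≡true : {b : Bool} → T b → b ≡ true
T⇒≡true = Equivalence.to T-≡

≡true⇒T : {b : Bool} → b ≡ true → T b
≡true⇒T = Equivalence.from T-≡

≡ᵇ-refl : (n : ℕ) → (n ≡ᵇ n) ≡ true
≡ᵇ-refl n = T⇒≡true (≡⇒≡ᵇ n n refl)

≡ᵇ-reflects-≡ : ∀ m n → Reflects (m ≡ n) (m ≡ᵇ n)
≡ᵇ-reflects-≡ m n = fromEquivalence (≡ᵇ⇒≡ m n) (≡⇒≡ᵇ m n)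

<ᵇ≡true : {a b : ℕ} → a < b → (a <ᵇ b) ≡ true
<ᵇ≡true a<b = T⇒≡true (<⇒<ᵇ a<b)

<ᵇ≡false : {a b : ℕ} → b ≤ a → (a <ᵇ b) ≡ false
<ᵇ≡false {a} {b} b≤a with a <ᵇ b | <ᵇ-reflects-< a b
... | true  | ofʸ a<b = ⊥-elim (<⇒≱ a<b b≤a)
... | false | _       = refl

<ᵇ≡false⇒≥ : {a b : ℕ} → (a <ᵇ b) ≡ false → b ≤ a
<ᵇ≡false⇒≥ {a} {b} e with a <ᵇ b | <ᵇ-reflects-< a b
<ᵇ≡false⇒≥ () | true  | _
... | false | ofⁿ a≮b = ≮⇒≥ a≮b

≡ᵇ≡false : {a b : ℕ} → a ≢ b → (a ≡ᵇ b) ≡ false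
≡ᵇ≡false {a} {b} a≢b with a ≡ᵇ b | ≡ᵇ-reflects-≡ a b
... | true  | ofʸ a≡b = ⊥-elim (a≢b a≡b)
... | false | _       = refl

≡ᵇ-+ : (m k : ℕ) → (m ≡ᵇ m + k) ≡ (k ≡ᵇ 0)
≡ᵇ-+ zero    zero    = refl
≡ᵇ-+ zero    (suc k) = refl
≡ᵇ-+ (suc m) k       = ≡ᵇ-+ m k

≤ᵇ-suc : (t x : ℕ) → (suc t ≤ᵇ suc x) ≡ (t ≤ᵇ x)
≤ᵇ-suc zero    x = refl
≤ᵇ-suc (suc t) x = refl

if-cong : {c c′ : Bool} {x x′ y y′ : A} → c ≡ c′ → x ≡ x′ → y ≡ y′ →
          (if c then x else y) ≡ (if c′ then x′ else y′)
if-cong refl refl refl = refl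

if-+ : (c : Bool) (u v : ℕ) → (if c then u + v else 0) ≡ (if c then u else 0) + (if c then v else 0)
if-+ true  u v = refl
if-+ false u v = refl

∧-false-third : (a b c : Bool) → a ∧ b ∧ false ∧ c ≡ false
∧-false-third a b c = trans (cong (a ∧_) (∧-zeroʳ b)) (∧-zeroʳ a)

allᵇ⇒All : (q : A → Bool) (xs : List A) → allᵇ q xs ≡ true → All (λ x → q x ≡ true) xs
allᵇ⇒All q []       _ = All.[]
allᵇ⇒All q (x ∷ xs) e = ∧-conicalˡ _ _ e All.∷ allᵇ⇒All q xs (∧-conicalʳ _ _ e)

All⇒allᵇ : (q : A → Bool) {xs : List A} → All (λ x → q x ≡ true) xs → allᵇ q xs ≡ true
All⇒allᵇ q All.[]         = refl
All⇒allᵇ q (qx All.∷ qxs) rewrite qx = All⇒allᵇ q qxs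

allᵇ-map : (q : B → Bool) (h : A → B) (xs : List A) → allᵇ q (map h xs) ≡ allᵇ (q ∘ h) xs
allᵇ-map q h []       = refl
allᵇ-map q h (x ∷ xs) = cong (q (h x) ∧_) (allᵇ-map q h xs)

allᵇ-cong : {p q : A → Bool} → (∀ x → p x ≡ q x) → (xs : List A) → allᵇ p xs ≡ allᵇ q xs
allᵇ-cong e []       = refl
allᵇ-cong e (x ∷ xs) = cong₂ _∧_ (e x) (allᵇ-cong e xs)

count : (A → Bool) → List A → ℕ
count p xs = length (filterᵇ p xs)

count-cong : {p q : A → Bool} (xs : List A) → (∀ {x} → x ∈ xs → p x ≡ q x) → count p xs ≡ count q xs
count-cong [] e = refl
count-cong {q = q} (x ∷ xs) e rewrite e (here refl) with q x
... | true  = cong suc (count-cong xs (e ∘ there))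
... | false = count-cong xs (e ∘ there)

count-map : (q : B → Bool) (h : A → B) (xs : List A) → count q (map h xs) ≡ count (q ∘ h) xs
count-map q h [] = refl
count-map q h (x ∷ xs) with q (h x)
... | true  = cong suc (count-map q h xs)
... | false = count-map q h xs

count-++ : (q : A → Bool) (xs ys : List A) → count q (xs ++ ys) ≡ count q xs + count q ys
count-++ q [] ys = refl
count-++ q (x ∷ xs) ys with q x
... | true  = cong suc (count-++ q xs ys)
... | false = count-++ q xs ys

count-split : (p q : A → Bool) (xs : List A) →
              count p xs ≡ count (λ x → p x ∧ q x) xs + count (λ x → p x ∧ not (q x)) xs
count-split p q [] = refl
count-split p q (x ∷ xs) with p x | q x
... | true  | true  = cong suc (count-split p q xs)
... | true  | false = trans (cong suc (count-split p q xs)) (sym (+-suc _ _))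
... | false | _     = count-split p q xs

count-∧-const : (p : A → Bool) (c : Bool) (xs : List A) →
                count (λ x → p x ∧ c) xs ≡ (if c then count p xs else 0)
count-∧-const p true  xs = count-cong xs (λ {x} _ → ∧-identityʳ (p x))
count-∧-const p false [] = refl
count-∧-const p false (x ∷ xs) with p x
... | true  = count-∧-const p false xs
... | false = count-∧-const p false xs

count-∷ : (q : A → Bool) {z : A} (ys : List A) → q z ≡ true → count q (z ∷ ys) ≡ suc (count q ys)
count-∷ q ys qz rewrite qz = refl

length≤count : (q : A → Bool) (zs ys : List A) → Unique zs →
               (∀ {z} → z ∈ zs → z ∈ ys × q z ≡ true) → length zs ≤ count q ys
length≤count q [] ys _ _ = z≤n
length≤count q (z ∷ zs) ys (z≢zs ∷ uniq) h with ∈-∃++ (proj₁ (h (here refl)))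
... | ys₁ , ys₂ , refl = begin
  suc (length zs)                  ≤⟨ s≤s (length≤count q zs (ys₁ ++ ys₂) uniq h′) ⟩
  suc (count q (ys₁ ++ ys₂))       ≡⟨ cong suc (count-++ q ys₁ ys₂) ⟩
  suc (count q ys₁ + count q ys₂)  ≡⟨ sym (+-suc (count q ys₁) _) ⟩
  count q ys₁ + suc (count q ys₂)  ≡⟨ cong (count q ys₁ +_) (sym (count-∷ q ys₂ qz)) ⟩
  count q ys₁ + count q (z ∷ ys₂)  ≡⟨ sym (count-++ q ys₁ (z ∷ ys₂)) ⟩
  count q (ys₁ ++ z ∷ ys₂)         ∎
  where
  open ≤-Reasoning
  qz : q z ≡ true
  qz = proj₂ (h (here refl))
  h′ : ∀ {w} → w ∈ zs → w ∈ ys₁ ++ ys₂ × q w ≡ true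
  h′ w∈zs with h (there w∈zs)
  ... | w∈ys , qw with ∈-++⁻ ys₁ w∈ys
  ... | inj₁ w∈ys₁          = ∈-++⁺ˡ w∈ys₁ , qw
  ... | inj₂ (here refl)    = ⊥-elim (All.lookup z≢zs w∈zs refl)
  ... | inj₂ (there w∈ys₂) = ∈-++⁺ʳ ys₁ w∈ys₂ , qw

count-≤-by-injection : (p : A → Bool) (q : B → Bool) (f : A → B) (g : B → A) (xs : List A) (ys : List B) →
  Unique xs → (∀ {x} → x ∈ xs → p x ≡ true → f x ∈ ys × q (f x) ≡ true × g (f x) ≡ x) →
  count p xs ≤ count q ys
count-≤-by-injection p q f g xs ys uxs h =
  subst (_≤ count q ys) (length-map f chosen) (length≤count q (map f chosen) ys unique-image image⊆)
  where
  chosen : List _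
  chosen = filterᵇ p xs
  chosen⊆ : ∀ {x} → x ∈ chosen → x ∈ xs × p x ≡ true
  chosen⊆ x∈ = let x∈xs , px = ∈-filter⁻ (T? ∘ p) x∈ in x∈xs , T⇒≡true px
  g∘f≗id : map g (map f chosen) ≡ chosen
  g∘f≗id = trans (sym (map-∘ chosen))
    (map-id-local (All.tabulate (λ x∈ → let x∈xs , px = chosen⊆ x∈ in proj₂ (proj₂ (h x∈xs px)))))
  -- f is injective on chosen because g undoes it there
  unique-image : Unique (map f chosen)
  unique-image = Unique.map⁻ (subst Unique (sym g∘f≗id) (Unique.filter⁺ (T? ∘ p) uxs))
  image⊆ : ∀ {y} → y ∈ map f chosen → y ∈ ys × q y ≡ true
  image⊆ y∈ with ∈-map⁻ f y∈
  ... | x , x∈ , refl = let x∈xs , px = chosen⊆ x∈ in proj₁ (h x∈xs px) , proj₁ (proj₂ (h x∈xs px))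

count-≡-by-bijection : (p : A → Bool) (q : B → Bool) (f : A → B) (g : B → A) (xs : List A) (ys : List B) →
  Unique xs → Unique ys →
  (∀ {x} → x ∈ xs → p x ≡ true → f x ∈ ys × q (f x) ≡ true × g (f x) ≡ x) →
  (∀ {y} → y ∈ ys → q y ≡ true → g y ∈ xs × p (g y) ≡ true × f (g y) ≡ y) →
  count p xs ≡ count q ys
count-≡-by-bijection p q f g xs ys uxs uys f-into g-into =
  ≤-antisym (count-≤-by-injection p q f g xs ys uxs f-into) (count-≤-by-injection q p g f ys xs uys g-into)

words : ℕ → List ℕ → List (List ℕ)
words zero    ys = [] ∷ []
words (suc m) ys = cartesianProductWith _∷_ ys (words m ys)

words-unique : (m : ℕ) {ys : List ℕ} → Unique ys → Unique (words m ys)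
words-unique zero    _ = All.[] ∷ []
words-unique (suc m) u = Unique.cartesianProductWith⁺ _∷_ ∷-injective u (words-unique m u)

∈-words⁺ : (m : ℕ) {ys xs : List ℕ} → length xs ≡ m → All (_∈ ys) xs → xs ∈ words m ys
∈-words⁺ zero    {xs = []}    _ _ = here refl
∈-words⁺ (suc m) {xs = x ∷ xs} l (x∈ All.∷ xs⊆) =
  ∈-cartesianProductWith⁺ _∷_ x∈ (∈-words⁺ m (suc-injective l) xs⊆)

∈-words⁻ : (m : ℕ) {ys xs : List ℕ} → xs ∈ words m ys → length xs ≡ m × All (_∈ ys) xs
∈-words⁻ zero    (here refl) = refl , All.[]
∈-words⁻ (suc m) {ys} xs∈ with ∈-cartesianProductWith⁻ _∷_ ys (words m ys) xs∈
... | y , r , y∈ , r∈ , refl = let l , r⊆ = ∈-words⁻ m r∈ in cong suc l , y∈ All.∷ r⊆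

IsWord : ℕ → List ℕ → Set
IsWord N xs = length xs ≡ N × All (_< N) xs

allWords : ℕ → List (List ℕ)
allWords N = words N (upTo N)

∈-allWords⁺ : {N : ℕ} {xs : List ℕ} → IsWord N xs → xs ∈ allWords N
∈-allWords⁺ {N} (l , bound) = ∈-words⁺ N l (All-map ∈-upTo⁺ bound)

∈-allWords⁻ : {N : ℕ} {xs : List ℕ} → xs ∈ allWords N → IsWord N xs
∈-allWords⁻ {N} xs∈ = let l , xs⊆ = ∈-words⁻ N xs∈ in l , All-map ∈-upTo⁻ xs⊆

count-allWords-cong : (N : ℕ) {p q : List ℕ → Bool} → (∀ xs → IsWord N xs → p xs ≡ q xs) →
                      count p (allWords N) ≡ count q (allWords N)
count-allWords-cong N e = count-cong (allWords N) (λ xs∈ → e _ (∈-allWords⁻ xs∈))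

count-allWords-bijection : (N M : ℕ) (p q : List ℕ → Bool) (f g : List ℕ → List ℕ) →
  (∀ {x} → IsWord N x → p x ≡ true → IsWord M (f x) × q (f x) ≡ true × g (f x) ≡ x) →
  (∀ {y} → IsWord M y → q y ≡ true → IsWord N (g y) × p (g y) ≡ true × f (g y) ≡ y) →
  count p (allWords N) ≡ count q (allWords M)
count-allWords-bijection N M p q f g f-into g-into =
  count-≡-by-bijection p q f g (allWords N) (allWords M) (words-unique N (Unique.upTo⁺ N)) (words-unique M (Unique.upTo⁺ M))
    (λ x∈ px → let w , qf , gf = f-into (∈-allWords⁻ x∈) px in ∈-allWords⁺ w , qf , gf)
    (λ y∈ qy → let w , pg , fg = g-into (∈-allWords⁻ y∈) qy in ∈-allWords⁺ w , pg , fg)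

toℕs : {n m : ℕ} → Vec (Fin n) m → List ℕ
toℕs v = toList (V.map toℕ v)

map-toℕs-allVec : {N : ℕ} (m : ℕ) (xs : List (Fin N)) → map toℕs (allVec m xs) ≡ words m (map toℕ xs)
map-toℕs-allVec zero    xs = refl
map-toℕs-allVec (suc m) xs = go xs
  where
  go : (ys : List (Fin _)) →
       map toℕs (concatMap (λ y → map (y V.∷_) (allVec m xs)) ys) ≡ cartesianProductWith _∷_ (map toℕ ys) (words m (map toℕ xs))
  go []       = refl
  go (y ∷ ys) = begin
    map toℕs (map (y V.∷_) (allVec m xs) ++ concatMap (λ y → map (y V.∷_) (allVec m xs)) ys)
      ≡⟨ map-++ toℕs (map (y V.∷_) (allVec m xs)) _ ⟩
    map toℕs (map (y V.∷_) (allVec m xs)) ++ map toℕs (concatMap (λ y → map (y V.∷_) (allVec m xs)) ys)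
      ≡⟨ cong₂ _++_ (trans (sym (map-∘ {g = toℕs} {f = y V.∷_} (allVec m xs)))
                           (trans (map-∘ {g = toℕ y ∷_} {f = toℕs} (allVec m xs)) (cong (map (toℕ y ∷_)) (map-toℕs-allVec m xs))))
                    (go ys) ⟩
    map (toℕ y ∷_) (words m (map toℕ xs)) ++ cartesianProductWith _∷_ (map toℕ ys) (words m (map toℕ xs)) ∎
    where open ≡-Reasoning

map-toℕ-tabulate : {n N : ℕ} (f : Fin n → Fin N) (h : ℕ → ℕ) → (∀ i → toℕ (f i) ≡ h (toℕ i)) →
                   map toℕ (toList (V.tabulate f)) ≡ applyUpTo h n
map-toℕ-tabulate {zero}  f h e = refl
map-toℕ-tabulate {suc n} f h e = cong₂ _∷_ (e fz) (map-toℕ-tabulate (f ∘ fs) (h ∘ suc) (e ∘ fs))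

map-toℕ-allFin : (n : ℕ) → map toℕ (toList (allFin n)) ≡ upTo n
map-toℕ-allFin n = map-toℕ-tabulate (λ i → i) (λ i → i) (λ _ → refl)

count-allVec : (N : ℕ) (P : List ℕ → Bool) (Q : Vec (Fin N) N → Bool) → (∀ v → Q v ≡ P (vals v)) →
               count Q (allVec N (toList (allFin N))) ≡ count P (allWords N)
count-allVec N P Q e = begin
  count Q (allVec N (toList (allFin N)))           ≡⟨ count-cong (allVec N _) (λ {v} _ → e v) ⟩
  count (P ∘ toℕs) (allVec N (toList (allFin N)))  ≡⟨ sym (count-map P toℕs (allVec N _)) ⟩
  count P (map toℕs (allVec N (toList (allFin N)))) ≡⟨ cong (count P) (map-toℕs-allVec N _) ⟩
  count P (words N (map toℕ (toList (allFin N))))  ≡⟨ cong (count P ∘ words N) (map-toℕ-allFin N) ⟩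
  count P (allWords N)                             ∎
  where open ≡-Reasoning

-- `nth` returns the junk value 0 outside the list; it is only ever read below the length.
nth : ℕ → List ℕ → ℕ
nth _       []       = 0
nth zero    (x ∷ xs) = x
nth (suc t) (x ∷ xs) = nth t xs

slice : (ℕ → ℕ) → ℕ → ℕ → List ℕ
slice f s zero    = []
slice f s (suc l) = f s ∷ slice f (suc s) l

length-slice : (f : ℕ → ℕ) (s l : ℕ) → length (slice f s l) ≡ l
length-slice f s zero    = refl
length-slice f s (suc l) = cong suc (length-slice f (suc s) l)

nth-slice : (f : ℕ → ℕ) (s l t : ℕ) → t < l → nth t (slice f s l) ≡ f (s + t)
nth-slice f s (suc l) zero    _         = cong f (sym (+-identityʳ s))
nth-slice f s (suc l) (suc t) (s≤s t<l) = trans (nth-slice f (suc s) l t t<l) (cong f (sym (+-suc s t)))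

slice-cong : (f g : ℕ → ℕ) (s s′ l : ℕ) → (∀ t → t < l → f (s + t) ≡ g (s′ + t)) → slice f s l ≡ slice g s′ l
slice-cong f g s s′ zero    e = refl
slice-cong f g s s′ (suc l) e = cong₂ _∷_
  (trans (cong f (sym (+-identityʳ s))) (trans (e 0 (s≤s z≤n)) (cong g (+-identityʳ s′))))
  (slice-cong f g (suc s) (suc s′) l
    (λ t t<l → trans (cong f (sym (+-suc s t))) (trans (e (suc t) (s≤s t<l)) (cong g (+-suc s′ t)))))

map-slice : (g f : ℕ → ℕ) (s l : ℕ) → map g (slice f s l) ≡ slice (g ∘ f) s l
map-slice g f s zero    = refl
map-slice g f s (suc l) = cong (g (f s) ∷_) (map-slice g f (suc s) l)

take-slice : (f : ℕ → ℕ) (s l M : ℕ) → l ≤ M → take l (slice f s M) ≡ slice f s l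
take-slice f s zero    M       _         = refl
take-slice f s (suc l) (suc M) (s≤s l≤M) = cong (f s ∷_) (take-slice f (suc s) l M l≤M)

drop-slice : (f : ℕ → ℕ) (s l M : ℕ) → drop l (slice f s M) ≡ slice f (s + l) (M ∸ l)
drop-slice f s zero    M       = cong (λ z → slice f z M) (sym (+-identityʳ s))
drop-slice f s (suc l) zero    = refl
drop-slice f s (suc l) (suc M) = trans (drop-slice f (suc s) l M) (cong (λ z → slice f z (M ∸ l)) (sym (+-suc s l)))

slice-suc : (f : ℕ → ℕ) (s l : ℕ) → slice f s (suc l) ≡ slice f s l ++ f (s + l) ∷ []
slice-suc f s zero    = cong (λ z → f z ∷ []) (sym (+-identityʳ s))
slice-suc f s (suc l) = cong (f s ∷_)
  (trans (slice-suc f (suc s) l) (cong (λ z → slice f (suc s) l ++ f z ∷ []) (sym (+-suc s l))))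

slice-nth : (xs : List ℕ) → xs ≡ slice (λ t → nth t xs) 0 (length xs)
slice-nth []       = refl
slice-nth (x ∷ xs) = cong (x ∷_) (trans (slice-nth xs) (slice-cong _ _ 0 1 (length xs) (λ _ _ → refl)))

≡-by-nth : (xs ys : List ℕ) → length xs ≡ length ys → (∀ t → t < length xs → nth t xs ≡ nth t ys) → xs ≡ ys
≡-by-nth xs ys l e = begin
  xs                                        ≡⟨ slice-nth xs ⟩
  slice (λ t → nth t xs) 0 (length xs)      ≡⟨ slice-cong _ _ 0 0 (length xs) e ⟩
  slice (λ t → nth t ys) 0 (length xs)      ≡⟨ cong (slice (λ t → nth t ys) 0) l ⟩
  slice (λ t → nth t ys) 0 (length ys)      ≡⟨ sym (slice-nth ys) ⟩
  ys                                        ∎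
  where open ≡-Reasoning

∈-slice⁻ : (f : ℕ → ℕ) (s l : ℕ) {x : ℕ} → x ∈ slice f s l → Σ ℕ λ t → t < l × x ≡ f (s + t)
∈-slice⁻ f s (suc l) (here e)  = 0 , s≤s z≤n , trans e (cong f (sym (+-identityʳ s)))
∈-slice⁻ f s (suc l) (there w) with ∈-slice⁻ f (suc s) l w
... | t , t<l , e = suc t , s≤s t<l , trans e (cong f (sym (+-suc s t)))

nth-∈ : (xs : List ℕ) (t : ℕ) → t < length xs → nth t xs ∈ xs
nth-∈ (x ∷ xs) zero    _         = here refl
nth-∈ (x ∷ xs) (suc t) (s≤s t<l) = there (nth-∈ xs t t<l)

IsWord-slice : (N : ℕ) (f : ℕ → ℕ) → (∀ t → t < N → f t < N) → IsWord N (slice f 0 N)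
IsWord-slice N f f< = length-slice f 0 N , All.tabulate (λ x∈ → let t , t<N , e = ∈-slice⁻ f 0 N x∈ in subst (_< N) (sym e) (f< t t<N))

nth-word-< : {N : ℕ} (xs : List ℕ) → IsWord N xs → (t : ℕ) → t < N → nth t xs < N
nth-word-< xs (l , bound) t t<N = All.lookup bound (nth-∈ xs t (subst (t <_) (sym l) t<N))

isInvolution : List ℕ → Bool
isInvolution xs = allᵇ (λ t → nth (nth t xs) xs ≡ᵇ t) (upTo (length xs))

isInvolution⇒ : (xs : List ℕ) → isInvolution xs ≡ true → ∀ t → t < length xs → nth (nth t xs) xs ≡ t
isInvolution⇒ xs e t t< = ≡ᵇ⇒≡ _ t (≡true⇒T (All.lookup (allᵇ⇒All _ (upTo (length xs)) e) (∈-upTo⁺ t<)))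

isInvolution⇐ : (xs : List ℕ) → (∀ t → t < length xs → nth (nth t xs) xs ≡ t) → isInvolution xs ≡ true
isInvolution⇐ xs inv = All⇒allᵇ _ (All.tabulate (λ {t} t∈ → T⇒≡true (≡⇒≡ᵇ _ t (inv t (∈-upTo⁻ t∈)))))

⌊≟⌋≡≡ᵇ : {n : ℕ} (a b : Fin n) → ⌊ a F.≟ b ⌋ ≡ (toℕ a ≡ᵇ toℕ b)
⌊≟⌋≡≡ᵇ a b with a F.≟ b | toℕ a ≡ᵇ toℕ b | ≡ᵇ-reflects-≡ (toℕ a) (toℕ b)
... | yes _   | true  | _      = refl
... | yes a≡b | false | ofⁿ ne = ⊥-elim (ne (cong toℕ a≡b))
... | no a≢b  | true  | ofʸ e  = ⊥-elim (a≢b (F.toℕ-injective e))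
... | no _    | false | _      = refl

toℕ-lookup : {n m : ℕ} (v : Vec (Fin n) m) (i : Fin m) → toℕ (lookup v i) ≡ nth (toℕ i) (toℕs v)
toℕ-lookup (x V.∷ v) fz     = refl
toℕ-lookup (x V.∷ v) (fs i) = toℕ-lookup v i

length-toℕs : {n m : ℕ} (v : Vec (Fin n) m) → length (toℕs v) ≡ m
length-toℕs V.[]       = refl
length-toℕs (x V.∷ v) = cong suc (length-toℕs v)

isInvol≡isInvolution : {n : ℕ} (v : Vec (Fin n) n) → isInvol v ≡ isInvolution (vals v)
isInvol≡isInvolution {n} v = begin
  allᵇ (λ j → ⌊ lookup v (lookup v j) F.≟ j ⌋) (toList (allFin n))
    ≡⟨ allᵇ-cong (λ j → trans (⌊≟⌋≡≡ᵇ (lookup v (lookup v j)) j)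
                    (cong (_≡ᵇ toℕ j) (trans (toℕ-lookup v (lookup v j)) (cong (λ t → nth t (vals v)) (toℕ-lookup v j)))))
                 (toList (allFin n)) ⟩
  allᵇ (inverts ∘ toℕ) (toList (allFin n))        ≡⟨ sym (allᵇ-map inverts toℕ (toList (allFin n))) ⟩
  allᵇ inverts (map toℕ (toList (allFin n)))      ≡⟨ cong (allᵇ inverts) (map-toℕ-allFin n) ⟩
  allᵇ inverts (upTo n)                           ≡⟨ cong (allᵇ inverts ∘ upTo) (sym (length-toℕs v)) ⟩
  isInvolution (vals v)                           ∎
  where
  open ≡-Reasoning
  inverts : ℕ → Bool
  inverts t = nth (nth t (vals v)) (vals v) ≡ᵇ t

isI : List ℕ → List ℕ → Bool
isI lam xs = isInvolution xs ∧ lamUnimodal lam xs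

isD : ℕ → List ℕ → List ℕ → Bool
isD i lam xs = isInvolution xs ∧ lamUnimodal lam xs ∧ firstLe (sum (take i lam)) xs ∧ decr (take (headPart lam) xs)

countI≡count-isI : (lam : List ℕ) → countI lam ≡ count (isI lam) (allWords (sum lam))
countI≡count-isI lam = count-allVec (sum lam) (isI lam) _
  (λ v → cong (_∧ lamUnimodal lam (vals v)) (isInvol≡isInvolution v))

countD≡count-isD : (i : ℕ) (lam : List ℕ) → countD i lam ≡ count (isD i lam) (allWords (sum lam))
countD≡count-isD i lam = count-allVec (sum lam) (isD i lam) _
  (λ v → cong (_∧ (lamUnimodal lam (vals v) ∧ firstLe (sum (take i lam)) (vals v) ∧ decr (take (headPart lam) (vals v))))
              (isInvol≡isInvolution v))

-- Standardisation

-- spread p enumerates ℕ ∖ {0, p} increasingly and squeeze p inverts it there: they standardise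
-- a permutation after its values 0 and p are deleted.
squeeze : ℕ → ℕ → ℕ
squeeze p x = if x <ᵇ p then x ∸ 1 else x ∸ 2

spread : ℕ → ℕ → ℕ
spread p y = if suc y <ᵇ p then suc y else suc (suc y)

squeeze-< : {p x : ℕ} → x < p → squeeze p x ≡ x ∸ 1
squeeze-< x<p rewrite <ᵇ≡true x<p = refl

squeeze-> : {p x : ℕ} → p < x → squeeze p x ≡ x ∸ 2
squeeze-> p<x rewrite <ᵇ≡false (<⇒≤ p<x) = refl

spread-< : {p y : ℕ} → suc y < p → spread p y ≡ suc y
spread-< lt rewrite <ᵇ≡true lt = refl

spread-≥ : {p y : ℕ} → p ≤ suc y → spread p y ≡ suc (suc y)
spread-≥ le rewrite <ᵇ≡false le = refl

squeeze-spread : (p y : ℕ) → squeeze p (spread p y) ≡ y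
squeeze-spread p y with suc y <? p
... | yes lt = trans (cong (squeeze p) (spread-< lt)) (squeeze-< lt)
... | no ¬lt = trans (cong (squeeze p) (spread-≥ (≮⇒≥ ¬lt))) (squeeze-> (s≤s (≮⇒≥ ¬lt)))

spread-squeeze : (p x : ℕ) → 1 ≤ p → x ≢ 0 → x ≢ p → spread p (squeeze p x) ≡ x
spread-squeeze p zero          _   x≢0 _   = ⊥-elim (x≢0 refl)
spread-squeeze p (suc x) 1≤p _ x≢p with suc x <? p
... | yes x<p = trans (cong (spread p) (squeeze-< x<p)) (spread-< x<p)
... | no x≮p  = above x (≤∧≢⇒< (≮⇒≥ x≮p) (x≢p ∘ sym))
  where
  above : (x : ℕ) → p < suc x → spread p (squeeze p (suc x)) ≡ suc x
  above zero    p<1 = ⊥-elim (<⇒≱ p<1 1≤p)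
  above (suc z) p<x = trans (cong (spread p) (squeeze-> p<x)) (spread-≥ (≤-pred p<x))

spread≢0 : (p y : ℕ) → spread p y ≢ 0
spread≢0 p y with suc y <? p
... | yes lt = 1+n≢0 ∘ trans (sym (spread-< lt))
... | no ¬lt = 1+n≢0 ∘ trans (sym (spread-≥ (≮⇒≥ ¬lt)))

spread≢p : (p y : ℕ) → spread p y ≢ p
spread≢p p y eq with suc y <? p
... | yes lt = <-irrefl (trans (sym (spread-< lt)) eq) lt
... | no ¬lt = <-irrefl (sym (trans (sym (spread-≥ (≮⇒≥ ¬lt))) eq)) (s≤s (≮⇒≥ ¬lt))

spread-bound : (p n y : ℕ) → y < n → spread p y < suc (suc n)
spread-bound p n y y<n with suc y <? p
... | yes lt = subst (_< suc (suc n)) (sym (spread-< lt)) (s≤s (≤-trans y<n (n≤1+n n)))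
... | no ¬lt = subst (_< suc (suc n)) (sym (spread-≥ (≮⇒≥ ¬lt))) (s≤s (s≤s y<n))

squeeze-bound : (p n x : ℕ) → 1 ≤ p → p ≤ suc n → x < suc (suc n) → x ≢ 0 → x ≢ p → squeeze p x < n
squeeze-bound p n x 1≤p p≤ x< x≢0 x≢p with x <? p
... | yes x<p = subst (_< n) (sym (squeeze-< x<p)) (∸-monoˡ-< (<-≤-trans x<p p≤) (n≢0⇒n>0 x≢0))
... | no x≮p  = subst (_< n) (sym (squeeze-> p<x)) (∸-monoˡ-< x< (≤-trans (s≤s 1≤p) p<x))
  where
  p<x : p < x
  p<x = ≤∧≢⇒< (≮⇒≥ x≮p) (x≢p ∘ sym)

spread-mono-< : (p : ℕ) {y y′ : ℕ} → y < y′ → spread p y < spread p y′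
spread-mono-< p {y} {y′} y<y′ with suc y <? p | suc y′ <? p
... | yes a | yes b = subst₂ _<_ (sym (spread-< a)) (sym (spread-< b)) (s≤s y<y′)
... | yes a | no b  = subst₂ _<_ (sym (spread-< a)) (sym (spread-≥ (≮⇒≥ b))) (s≤s (≤-trans y<y′ (n≤1+n _)))
... | no a  | yes b = ⊥-elim (a (<-trans (s≤s y<y′) b))
... | no a  | no b  = subst₂ _<_ (sym (spread-≥ (≮⇒≥ a))) (sym (spread-≥ (≮⇒≥ b))) (s≤s (s≤s y<y′))

spread-<ᵇ-p : (p y : ℕ) → (spread p y <ᵇ p) ≡ (suc y <ᵇ p)
spread-<ᵇ-p p y with suc y <? p
... | yes lt = cong (_<ᵇ p) (spread-< lt)
... | no ¬lt = trans (cong (_<ᵇ p) (spread-≥ (≮⇒≥ ¬lt))) (trans (<ᵇ≡false (≤-trans (≮⇒≥ ¬lt) (n≤1+n _))) (sym (<ᵇ≡false (≮⇒≥ ¬lt))))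

<ᵇ-Preserving : (ℕ → ℕ) → Set
<ᵇ-Preserving f = ∀ a b → (f a <ᵇ f b) ≡ (a <ᵇ b)

strictMono⇒<ᵇ-Preserving : (f : ℕ → ℕ) → (∀ {a b} → a < b → f a < f b) → <ᵇ-Preserving f
strictMono⇒<ᵇ-Preserving f mono a b with a <? b
... | yes a<b = trans (<ᵇ≡true (mono a<b)) (sym (<ᵇ≡true a<b))
... | no a≮b  = trans (<ᵇ≡false fb≤fa) (sym (<ᵇ≡false (≮⇒≥ a≮b)))
  where
  fb≤fa : f b ≤ f a
  fb≤fa with m≤n⇒m<n∨m≡n (≮⇒≥ a≮b)
  ... | inj₁ b<a  = <⇒≤ (mono b<a)
  ... | inj₂ refl = ≤-refl

spread-<ᵇ-Preserving : (p : ℕ) → <ᵇ-Preserving (spread p)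
spread-<ᵇ-Preserving p = strictMono⇒<ᵇ-Preserving (spread p) (spread-mono-< p)

decr-map : (f : ℕ → ℕ) → <ᵇ-Preserving f → (xs : List ℕ) → decr (map f xs) ≡ decr xs
decr-map f mono []          = refl
decr-map f mono (a ∷ [])    = refl
decr-map f mono (a ∷ b ∷ r) = cong₂ _∧_ (mono b a) (decr-map f mono (b ∷ r))

unimodal-map : (f : ℕ → ℕ) → <ᵇ-Preserving f → (xs : List ℕ) → unimodal (map f xs) ≡ unimodal xs
unimodal-map f mono []          = refl
unimodal-map f mono (a ∷ [])    = refl
unimodal-map f mono (a ∷ b ∷ r) =
  if-cong (mono a b) (unimodal-map f mono (b ∷ r)) (cong₂ _∧_ (mono b a) (decr-map f mono (b ∷ r)))

decr⇒unimodal : (xs : List ℕ) → decr xs ≡ true → unimodal xs ≡ true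
decr⇒unimodal []          _ = refl
decr⇒unimodal (a ∷ [])    _ = refl
decr⇒unimodal (a ∷ b ∷ r) d with a <ᵇ b | <ᵇ-reflects-< a b
... | false | _       = d
... | true  | ofʸ a<b rewrite <ᵇ≡false {b} {a} (<⇒≤ a<b) with d
...   | ()

unimodal-0∷ : (xs : List ℕ) → All (_≢ 0) xs → unimodal (0 ∷ xs) ≡ unimodal xs
unimodal-0∷ []            _                = refl
unimodal-0∷ (zero ∷ r)    (0≢0 All.∷ _)    = ⊥-elim (0≢0 refl)
unimodal-0∷ (suc b ∷ r)   _                = refl

decr-∷ʳ0 : (xs : List ℕ) → All (_≢ 0) xs → decr (xs ++ 0 ∷ []) ≡ decr xs
decr-∷ʳ0 []          _                   = refl
decr-∷ʳ0 (zero ∷ [])  (0≢0 All.∷ _)      = ⊥-elim (0≢0 refl)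
decr-∷ʳ0 (suc a ∷ []) _                  = refl
decr-∷ʳ0 (a ∷ b ∷ r) (_ All.∷ nonzero)   = cong ((b <ᵇ a) ∧_) (decr-∷ʳ0 (b ∷ r) nonzero)

unimodal-∷ʳ0 : (xs : List ℕ) → All (_≢ 0) xs → unimodal (xs ++ 0 ∷ []) ≡ unimodal xs
unimodal-∷ʳ0 []           _                 = refl
unimodal-∷ʳ0 (zero ∷ [])  (0≢0 All.∷ _)     = ⊥-elim (0≢0 refl)
unimodal-∷ʳ0 (suc a ∷ []) _                 = refl
unimodal-∷ʳ0 (a ∷ b ∷ r)  (_ All.∷ nonzero) =
  if-cong {c = a <ᵇ b} refl (unimodal-∷ʳ0 (b ∷ r) nonzero) (cong ((b <ᵇ a) ∧_) (decr-∷ʳ0 (b ∷ r) nonzero))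

decr-0⇒last : (xs : List ℕ) (q : ℕ) → decr xs ≡ true → nth q xs ≡ 0 → q < length xs → suc q ≡ length xs
decr-0⇒last (a ∷ [])    zero    _ _ _ = refl
decr-0⇒last (a ∷ [])    (suc q) _ _ (s≤s ())
decr-0⇒last (a ∷ b ∷ r) zero    d z _ rewrite z with d
... | ()
decr-0⇒last (a ∷ b ∷ r) (suc q) d z (s≤s q<) = cong suc (decr-0⇒last (b ∷ r) q (∧-conicalʳ _ _ d) z q<)

unimodal-0⇒end : (xs : List ℕ) (q : ℕ) → unimodal xs ≡ true → nth q xs ≡ 0 → q < length xs →
                 q ≡ 0 ⊎ suc q ≡ length xs
unimodal-0⇒end xs          zero    _ _ _ = inj₁ refl
unimodal-0⇒end (a ∷ [])    (suc q) _ _ (s≤s ())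
unimodal-0⇒end (a ∷ b ∷ r) (suc q) u z (s≤s q<) with a <ᵇ b | <ᵇ-reflects-< a b
... | false | _ = inj₂ (decr-0⇒last (a ∷ b ∷ r) (suc q) u z (s≤s q<))
... | true  | ofʸ a<b with unimodal-0⇒end (b ∷ r) q u z q<
...   | inj₂ last = inj₂ (cong suc last)
...   | inj₁ refl = ⊥-elim (<⇒≱ a<b (subst (_≤ a) (sym z) z≤n))

unimodalBlocks : (ℕ → ℕ) → ℕ → List ℕ → Bool
unimodalBlocks f s []       = true
unimodalBlocks f s (l ∷ ls) = unimodal (slice f s l) ∧ unimodalBlocks f (s + l) ls

segments-slice : (f : ℕ → ℕ) (s M : ℕ) (ls : List ℕ) → sum ls ≤ M →
                 allᵇ unimodal (segments (slice f s M) ls) ≡ unimodalBlocks f s ls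
segments-slice f s M []       _   = refl
segments-slice f s M (l ∷ ls) ≤M = cong₂ _∧_
  (cong unimodal (take-slice f s l M (≤-trans (m≤m+n l (sum ls)) ≤M)))
  (trans (cong (λ z → allᵇ unimodal (segments z ls)) (drop-slice f s l M))
         (segments-slice f (s + l) (M ∸ l) ls (subst (_≤ M ∸ l) (m+n∸m≡n l (sum ls)) (∸-monoˡ-≤ l ≤M))))

lamUnimodal≡unimodalBlocks : (lam xs : List ℕ) → sum lam ≤ length xs →
                             lamUnimodal lam xs ≡ unimodalBlocks (λ t → nth t xs) 0 lam
lamUnimodal≡unimodalBlocks lam xs ≤len =
  trans (cong (λ z → allᵇ unimodal (segments z lam)) (slice-nth xs)) (segments-slice _ 0 (length xs) lam ≤len)

unimodalBlocks-++ : (f : ℕ → ℕ) (s : ℕ) (α γ : List ℕ) →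
                    unimodalBlocks f s (α ++ γ) ≡ unimodalBlocks f s α ∧ unimodalBlocks f (s + sum α) γ
unimodalBlocks-++ f s []      γ = cong (λ z → unimodalBlocks f z γ) (sym (+-identityʳ s))
unimodalBlocks-++ f s (l ∷ α) γ = trans
  (cong (unimodal (slice f s l) ∧_)
    (trans (unimodalBlocks-++ f (s + l) α γ) (cong (λ z → unimodalBlocks f (s + l) α ∧ unimodalBlocks f z γ) (+-assoc s l (sum α)))))
  (sym (∧-assoc (unimodal (slice f s l)) _ _))

unimodalBlocks-cong : (f f′ g : ℕ → ℕ) → <ᵇ-Preserving g → (s s′ : ℕ) (ls : List ℕ) →
                      (∀ t → t < sum ls → f (s + t) ≡ g (f′ (s′ + t))) → unimodalBlocks f s ls ≡ unimodalBlocks f′ s′ ls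
unimodalBlocks-cong f f′ g mono s s′ []       e = refl
unimodalBlocks-cong f f′ g mono s s′ (l ∷ ls) e = cong₂ _∧_
  (begin
    unimodal (slice f s l)          ≡⟨ cong unimodal (slice-cong f (g ∘ f′) s s′ l (λ t t< → e t (≤-trans t< (m≤m+n l (sum ls))))) ⟩
    unimodal (slice (g ∘ f′) s′ l)  ≡⟨ cong unimodal (sym (map-slice g f′ s′ l)) ⟩
    unimodal (map g (slice f′ s′ l)) ≡⟨ unimodal-map g mono (slice f′ s′ l) ⟩
    unimodal (slice f′ s′ l)        ∎)
  (unimodalBlocks-cong f f′ g mono (s + l) (s′ + l) ls
    (λ t t< → trans (cong f (+-assoc s l t)) (trans (e (l + t) (+-monoʳ-< l t<)) (cong (g ∘ f′) (sym (+-assoc s′ l t))))))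
  where open ≡-Reasoning

lamUnimodal-drop0 : (γ β xs : List ℕ) → lamUnimodal (γ ++ 0 ∷ β) xs ≡ lamUnimodal (γ ++ β) xs
lamUnimodal-drop0 []      β xs = refl
lamUnimodal-drop0 (l ∷ γ) β xs = cong (unimodal (take l xs) ∧_) (lamUnimodal-drop0 γ β (drop l xs))

-- Deleting a 2-cycle

-- Positions and values are 0-based: π ∈ D^λ with π₀ = p has the 2-cycle (0 p), and
-- p is the first or the last position of the i-th block of λ = (l₁ + 1, α, lᵢ + 1, β).
module TwoCycle (l₁ lᵢ : ℕ) (α β : List ℕ) (p : ℕ)
                (p-end : (p ≡ suc l₁ + sum α) ⊎ (p ≡ suc l₁ + sum α + lᵢ)) where

  n N start : ℕ
  n     = l₁ + (sum α + (lᵢ + sum β))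
  N     = suc (suc n)
  start = suc l₁ + sum α

  lam lam′ : List ℕ
  lam  = suc l₁ ∷ (α ++ suc lᵢ ∷ β)
  lam′ = l₁ ∷ (α ++ lᵢ ∷ β)

  sum-lam : sum lam ≡ N
  sum-lam = cong suc (trans (cong (l₁ +_) (trans (sum-++ α (suc lᵢ ∷ β)) (+-suc (sum α) (lᵢ + sum β))))
                            (+-suc l₁ (sum α + (lᵢ + sum β))))

  sum-lam′ : sum lam′ ≡ n
  sum-lam′ = cong (l₁ +_) (sum-++ α (lᵢ ∷ β))

  start≤p : start ≤ p
  start≤p = [ (λ e → ≤-reflexive (sym e)) , (λ e → subst (start ≤_) (sym e) (m≤m+n start lᵢ)) ]′ p-end

  p≤end : p ≤ start + lᵢ
  p≤end = [ (λ e → subst (_≤ start + lᵢ) (sym e) (m≤m+n start lᵢ)) , ≤-reflexive ]′ p-end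

  1≤p : 1 ≤ p
  1≤p = ≤-trans (s≤s z≤n) start≤p

  p≢0 : p ≢ 0
  p≢0 = >⇒≢ 1≤p

  p≤1+n : p ≤ suc n
  p≤1+n = ≤-trans p≤end (s≤s (subst (_≤ n) (sym (+-assoc l₁ (sum α) lᵢ))
            (+-monoʳ-≤ l₁ (+-monoʳ-≤ (sum α) (m≤m+n lᵢ (sum β))))))

  p<N : p < N
  p<N = s≤s p≤1+n

  withCycle : List ℕ → ℕ → ℕ
  withCycle σ J = if J ≡ᵇ 0 then p else if J ≡ᵇ p then 0 else spread p (nth (squeeze p J) σ)

  insertCycle : List ℕ → List ℕ
  insertCycle σ = slice (withCycle σ) 0 N

  deleteCycle : List ℕ → List ℕ
  deleteCycle π = slice (λ t → squeeze p (nth (spread p t) π)) 0 n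

  withCycle-p : (σ : List ℕ) → withCycle σ p ≡ 0
  withCycle-p σ rewrite ≡ᵇ≡false p≢0 | ≡ᵇ-refl p = refl

  withCycle-other : (σ : List ℕ) {J : ℕ} → J ≢ 0 → J ≢ p → withCycle σ J ≡ spread p (nth (squeeze p J) σ)
  withCycle-other σ J≢0 J≢p rewrite ≡ᵇ≡false J≢0 | ≡ᵇ≡false J≢p = refl

  withCycle-spread : (σ : List ℕ) (t : ℕ) → withCycle σ (spread p t) ≡ spread p (nth t σ)
  withCycle-spread σ t = trans (withCycle-other σ (spread≢0 p t) (spread≢p p t))
                               (cong (λ z → spread p (nth z σ)) (squeeze-spread p t))

  withCycle-below : (σ : List ℕ) {J : ℕ} → 1 ≤ J → J < p → withCycle σ J ≡ spread p (nth (J ∸ 1) σ)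
  withCycle-below σ 1≤J J<p = trans (withCycle-other σ (>⇒≢ 1≤J) (<⇒≢ J<p))
                                    (cong (λ z → spread p (nth z σ)) (squeeze-< J<p))

  withCycle-above : (σ : List ℕ) {J : ℕ} → p < J → withCycle σ J ≡ spread p (nth (J ∸ 2) σ)
  withCycle-above σ p<J = trans (withCycle-other σ (>⇒≢ (≤-trans (s≤s z≤n) p<J)) (>⇒≢ p<J))
                                (cong (λ z → spread p (nth z σ)) (squeeze-> p<J))

  withCycle-bound : (σ : List ℕ) → IsWord n σ → (J : ℕ) → J < N → withCycle σ J < N
  withCycle-bound σ σ-word J J<N with J ≟ 0 | J ≟ p
  ... | yes refl | _        = p<N
  ... | no J≢0   | yes refl = subst (_< N) (sym (withCycle-p σ)) (s≤s z≤n)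
  ... | no J≢0   | no J≢p   = subst (_< N) (sym (withCycle-other σ J≢0 J≢p))
    (spread-bound p n _ (nth-word-< σ σ-word (squeeze p J) (squeeze-bound p n J 1≤p p≤1+n J<N J≢0 J≢p)))

  IsWord-insertCycle : (σ : List ℕ) → IsWord n σ → IsWord N (insertCycle σ)
  IsWord-insertCycle σ σ-word = IsWord-slice N (withCycle σ) (withCycle-bound σ σ-word)

  nth-insertCycle : (σ : List ℕ) (J : ℕ) → J < N → nth J (insertCycle σ) ≡ withCycle σ J
  nth-insertCycle σ = nth-slice (withCycle σ) 0 N

  nth-deleteCycle : (π : List ℕ) (t : ℕ) → t < n → nth t (deleteCycle π) ≡ squeeze p (nth (spread p t) π)
  nth-deleteCycle π = nth-slice _ 0 n

  deleteCycle-insertCycle : (σ : List ℕ) → IsWord n σ → deleteCycle (insertCycle σ) ≡ σ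
  deleteCycle-insertCycle σ (len , _) = ≡-by-nth _ σ (trans (length-slice _ 0 n) (sym len)) λ t t<l →
    let t<n = subst (t <_) (length-slice _ 0 n) t<l in
    begin
      nth t (deleteCycle (insertCycle σ))              ≡⟨ nth-deleteCycle (insertCycle σ) t t<n ⟩
      squeeze p (nth (spread p t) (insertCycle σ))     ≡⟨ cong (squeeze p) (nth-insertCycle σ (spread p t) (spread-bound p n t t<n)) ⟩
      squeeze p (withCycle σ (spread p t))             ≡⟨ cong (squeeze p) (withCycle-spread σ t) ⟩
      squeeze p (spread p (nth t σ))                   ≡⟨ squeeze-spread p _ ⟩
      nth t σ                                          ∎
    where open ≡-Reasoning

  module _ (π : List ℕ) (π-word : IsWord N π) (π-inv : isInvolution π ≡ true) (π₀≡p : nth 0 π ≡ p) where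

    private
      inv : ∀ t → t < N → nth (nth t π) π ≡ t
      inv t t<N = isInvolution⇒ π π-inv t (subst (t <_) (sym (proj₁ π-word)) t<N)

      πₚ≡0 : nth p π ≡ 0
      πₚ≡0 = trans (cong (λ z → nth z π) (sym π₀≡p)) (inv 0 (s≤s z≤n))

      π≢0 : (J : ℕ) → J < N → J ≢ p → nth J π ≢ 0
      π≢0 J J<N J≢p e = J≢p (trans (sym (inv J J<N)) (trans (cong (λ z → nth z π) e) π₀≡p))

      π≢p : (J : ℕ) → J < N → J ≢ 0 → nth J π ≢ p
      π≢p J J<N J≢0 e = J≢0 (trans (sym (inv J J<N)) (trans (cong (λ z → nth z π) e) πₚ≡0))

    IsWord-deleteCycle : IsWord n (deleteCycle π)
    IsWord-deleteCycle = IsWord-slice n _ λ t t<n →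
      let J<N = spread-bound p n t t<n in
      squeeze-bound p n (nth (spread p t) π) 1≤p p≤1+n (nth-word-< π π-word _ J<N)
        (π≢0 _ J<N (spread≢p p t)) (π≢p _ J<N (spread≢0 p t))

    insertCycle-deleteCycle : insertCycle (deleteCycle π) ≡ π
    insertCycle-deleteCycle = ≡-by-nth _ π (trans (length-slice _ 0 N) (sym (proj₁ π-word))) λ J J<l →
      let J<N = subst (J <_) (length-slice _ 0 N) J<l in
      trans (nth-insertCycle (deleteCycle π) J J<N) (entry J J<N)
      where
      entry : (J : ℕ) → J < N → withCycle (deleteCycle π) J ≡ nth J π
      entry J J<N with J ≟ 0 | J ≟ p
      ... | yes refl | _        = sym π₀≡p
      ... | no J≢0   | yes refl = trans (withCycle-p (deleteCycle π)) (sym πₚ≡0)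
      ... | no J≢0   | no J≢p   = begin
        withCycle (deleteCycle π) J
          ≡⟨ withCycle-other (deleteCycle π) J≢0 J≢p ⟩
        spread p (nth (squeeze p J) (deleteCycle π))
          ≡⟨ cong (spread p) (nth-deleteCycle π (squeeze p J) (squeeze-bound p n J 1≤p p≤1+n J<N J≢0 J≢p)) ⟩
        spread p (squeeze p (nth (spread p (squeeze p J)) π))
          ≡⟨ cong (λ z → spread p (squeeze p (nth z π))) (spread-squeeze p J 1≤p J≢0 J≢p) ⟩
        spread p (squeeze p (nth J π))
          ≡⟨ spread-squeeze p (nth J π) 1≤p (π≢0 J J<N J≢p) (π≢p J J<N J≢0) ⟩
        nth J π
          ∎
        where open ≡-Reasoning

  withCycle-involutive : (σ : List ℕ) → IsWord n σ → isInvolution σ ≡ true →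
                         (J : ℕ) → J < N → withCycle σ (withCycle σ J) ≡ J
  withCycle-involutive σ (len , _) σ-inv J J<N with J ≟ 0 | J ≟ p
  ... | yes refl | _        = withCycle-p σ
  ... | no J≢0   | yes refl = cong (withCycle σ) (withCycle-p σ)
  ... | no J≢0   | no J≢p   = begin
    withCycle σ (withCycle σ J)             ≡⟨ cong (withCycle σ) (withCycle-other σ J≢0 J≢p) ⟩
    withCycle σ (spread p (nth t σ))        ≡⟨ withCycle-spread σ (nth t σ) ⟩
    spread p (nth (nth t σ) σ)              ≡⟨ cong (spread p) (isInvolution⇒ σ σ-inv t (subst (t <_) (sym len) t<n)) ⟩
    spread p t                              ≡⟨ spread-squeeze p J 1≤p J≢0 J≢p ⟩
    J                                       ∎
    where
    open ≡-Reasoning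
    t : ℕ
    t = squeeze p J
    t<n : t < n
    t<n = squeeze-bound p n J 1≤p p≤1+n J<N J≢0 J≢p

  isInvolution-insertCycle : (σ : List ℕ) → IsWord n σ → isInvolution (insertCycle σ) ≡ isInvolution σ
  isInvolution-insertCycle σ σ-word = ⇔→≡ {z = true} (mk⇔ reflect preserve)
    where
    nth-insertCycle-spread : (u : ℕ) → u < n → nth (spread p u) (insertCycle σ) ≡ spread p (nth u σ)
    nth-insertCycle-spread u u<n = trans (nth-insertCycle σ (spread p u) (spread-bound p n u u<n)) (withCycle-spread σ u)

    preserve : isInvolution σ ≡ true → isInvolution (insertCycle σ) ≡ true
    preserve σ-inv = isInvolution⇐ (insertCycle σ) λ J J<l →
      let J<N = subst (J <_) (length-slice _ 0 N) J<l in
      trans (cong (λ z → nth z (insertCycle σ)) (nth-insertCycle σ J J<N))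
        (trans (nth-insertCycle σ (withCycle σ J) (withCycle-bound σ σ-word J J<N))
          (withCycle-involutive σ σ-word σ-inv J J<N))

    reflect : isInvolution (insertCycle σ) ≡ true → isInvolution σ ≡ true
    reflect ins-inv = isInvolution⇐ σ λ t t<l →
      let t<n = subst (t <_) (proj₁ σ-word) t<l
          y   = nth t σ
          spread-inv : spread p (nth y σ) ≡ spread p t
          spread-inv = begin
            spread p (nth y σ)
              ≡⟨ sym (nth-insertCycle-spread y (nth-word-< σ σ-word t t<n)) ⟩
            nth (spread p y) (insertCycle σ)
              ≡⟨ cong (λ z → nth z (insertCycle σ)) (sym (nth-insertCycle-spread t t<n)) ⟩
            nth (nth (spread p t) (insertCycle σ)) (insertCycle σ)
              ≡⟨ isInvolution⇒ (insertCycle σ) ins-inv (spread p t)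
                   (subst (spread p t <_) (sym (length-slice _ 0 N)) (spread-bound p n t t<n)) ⟩
            spread p t
              ∎
      in trans (sym (squeeze-spread p (nth y σ))) (trans (cong (squeeze p) spread-inv) (squeeze-spread p t))
      where open ≡-Reasoning

  headBelow : List ℕ → Bool
  headBelow σ = if l₁ ≡ᵇ 0 then true else firstLe (p ∸ 1) σ

  isDWithHead : List ℕ → Bool
  isDWithHead π = isInvolution π ∧ lamUnimodal lam π ∧ (nth 0 π ≡ᵇ p) ∧ decr (take (suc l₁) π)

  isDResidue : List ℕ → Bool
  isDResidue σ = isInvolution σ ∧ lamUnimodal lam′ σ ∧ headBelow σ ∧ decr (take l₁ σ)

  module _ (σ : List ℕ) (σ-word : IsWord n σ) where
    private
      h : ℕ → ℕ
      h t = nth t σ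

      spread-nonzero : (xs : List ℕ) → All (_≢ 0) (map (spread p) xs)
      spread-nonzero xs = All.tabulate λ y∈ → let y , _ , e = ∈-map⁻ (spread p) y∈ in subst (_≢ 0) (sym e) (spread≢0 p y)

      mono : <ᵇ-Preserving (spread p)
      mono = spread-<ᵇ-Preserving p

      l₁≤n : l₁ ≤ length σ
      l₁≤n = subst (l₁ ≤_) (sym (proj₁ σ-word)) (m≤m+n l₁ _)

      take-l₁ : take l₁ σ ≡ slice h 0 l₁
      take-l₁ = trans (cong (take l₁) (slice-nth σ)) (take-slice h 0 l₁ (length σ) l₁≤n)

    laterBlocksUnimodal : Bool
    laterBlocksUnimodal = unimodalBlocks h l₁ α ∧ (unimodal (slice h (l₁ + sum α) lᵢ) ∧ unimodalBlocks h (l₁ + sum α + lᵢ) β)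

    lamUnimodal-residue : lamUnimodal lam′ σ ≡ unimodal (slice h 0 l₁) ∧ laterBlocksUnimodal
    lamUnimodal-residue = trans (lamUnimodal≡unimodalBlocks lam′ σ (≤-reflexive (trans sum-lam′ (sym (proj₁ σ-word)))))
      (cong (unimodal (slice h 0 l₁) ∧_) (unimodalBlocks-++ h l₁ α (lᵢ ∷ β)))

    firstBlock-insertCycle : slice (withCycle σ) 0 (suc l₁) ≡ p ∷ map (spread p) (slice h 0 l₁)
    firstBlock-insertCycle = cong (p ∷_) (trans
      (slice-cong (withCycle σ) (spread p ∘ h) 1 0 l₁
        (λ t t< → withCycle-below σ (s≤s z≤n) (≤-trans (s≤s t<) (≤-trans (s≤s (m≤m+n l₁ (sum α))) start≤p))))
      (sym (map-slice (spread p) h 0 l₁)))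

    αBlocks-insertCycle : unimodalBlocks (withCycle σ) (suc l₁) α ≡ unimodalBlocks h l₁ α
    αBlocks-insertCycle = unimodalBlocks-cong (withCycle σ) h (spread p) mono (suc l₁) l₁ α
      (λ t t< → withCycle-below σ (s≤s z≤n) (≤-trans (s≤s (+-monoʳ-< l₁ t<)) start≤p))

    βBlocks-insertCycle : unimodalBlocks (withCycle σ) (start + suc lᵢ) β ≡ unimodalBlocks h (l₁ + sum α + lᵢ) β
    βBlocks-insertCycle = unimodalBlocks-cong (withCycle σ) h (spread p) mono (start + suc lᵢ) (l₁ + sum α + lᵢ) β
      (λ t _ → trans (withCycle-above σ (≤-trans (s≤s p≤end) (≤-trans (≤-reflexive (sym (+-suc start lᵢ))) (m≤m+n (start + suc lᵢ) t))))
                     (cong (λ z → spread p (nth (z ∸ 2) σ)) (cong (_+ t) (cong suc (+-suc (l₁ + sum α) lᵢ)))))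

    -- The i-th block of the insertion is that of σ (spread) with the new minimum 0 added at one end.
    iBlock-insertCycle : unimodal (slice (withCycle σ) start (suc lᵢ)) ≡ unimodal (slice h (l₁ + sum α) lᵢ)
    iBlock-insertCycle = [ at-start , at-end ]′ p-end
      where
      open ≡-Reasoning
      block : List ℕ
      block = slice h (l₁ + sum α) lᵢ
      zero-at : {J : ℕ} → p ≡ J → withCycle σ J ≡ 0
      zero-at p≡J = subst (λ z → withCycle σ z ≡ 0) p≡J (withCycle-p σ)

      at-start : p ≡ start → unimodal (slice (withCycle σ) start (suc lᵢ)) ≡ unimodal block
      at-start p≡start = begin
        unimodal (slice (withCycle σ) start (suc lᵢ)) ≡⟨ cong unimodal (cong₂ _∷_ (zero-at p≡start) spread-block) ⟩
        unimodal (0 ∷ map (spread p) block)          ≡⟨ unimodal-0∷ _ (spread-nonzero block) ⟩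
        unimodal (map (spread p) block)              ≡⟨ unimodal-map (spread p) mono block ⟩
        unimodal block                               ∎
        where
        spread-block : slice (withCycle σ) (suc start) lᵢ ≡ map (spread p) block
        spread-block = trans (slice-cong (withCycle σ) (spread p ∘ h) (suc start) (l₁ + sum α) lᵢ
                                (λ t _ → withCycle-above σ (subst (_< suc start + t) (sym p≡start) (s≤s (m≤m+n start t)))))
                             (sym (map-slice (spread p) h (l₁ + sum α) lᵢ))

      at-end : p ≡ start + lᵢ → unimodal (slice (withCycle σ) start (suc lᵢ)) ≡ unimodal block
      at-end p≡end = begin
        unimodal (slice (withCycle σ) start (suc lᵢ))
          ≡⟨ cong unimodal (trans (slice-suc (withCycle σ) start lᵢ) (cong₂ _++_ spread-block (cong (_∷ []) (zero-at p≡end)))) ⟩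
        unimodal (map (spread p) block ++ 0 ∷ [])    ≡⟨ unimodal-∷ʳ0 _ (spread-nonzero block) ⟩
        unimodal (map (spread p) block)              ≡⟨ unimodal-map (spread p) mono block ⟩
        unimodal block                               ∎
        where
        spread-block : slice (withCycle σ) start lᵢ ≡ map (spread p) block
        spread-block = trans (slice-cong (withCycle σ) (spread p ∘ h) start (l₁ + sum α) lᵢ
                                (λ t t< → withCycle-below σ (s≤s z≤n) (subst (start + t <_) (sym p≡end) (+-monoʳ-< start t<))))
                             (sym (map-slice (spread p) h (l₁ + sum α) lᵢ))

    lamUnimodal-insertCycle : lamUnimodal lam (insertCycle σ) ≡ unimodal (slice (withCycle σ) 0 (suc l₁)) ∧ laterBlocksUnimodal
    lamUnimodal-insertCycle = trans (segments-slice (withCycle σ) 0 N lam (≤-reflexive sum-lam))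
      (cong (unimodal (slice (withCycle σ) 0 (suc l₁)) ∧_)
        (trans (unimodalBlocks-++ (withCycle σ) (suc l₁) α (suc lᵢ ∷ β))
          (cong₂ _∧_ αBlocks-insertCycle (cong₂ _∧_ iBlock-insertCycle βBlocks-insertCycle))))

    decr-firstBlock-insertCycle : decr (take (suc l₁) (insertCycle σ)) ≡ headBelow σ ∧ decr (take l₁ σ)
    decr-firstBlock-insertCycle = begin
      decr (take (suc l₁) (insertCycle σ))
        ≡⟨ cong decr (trans (take-slice (withCycle σ) 0 (suc l₁) N (s≤s (≤-trans (m≤m+n l₁ _) (n≤1+n n)))) firstBlock-insertCycle) ⟩
      decr (p ∷ map (spread p) (slice h 0 l₁))      ≡⟨ decr-p∷ l₁ σ l₁≤n ⟩
      headBelow σ ∧ decr (slice h 0 l₁)             ≡⟨ cong (λ z → headBelow σ ∧ decr z) (sym take-l₁) ⟩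
      headBelow σ ∧ decr (take l₁ σ)                ∎
      where
      open ≡-Reasoning
      decr-p∷ : (k : ℕ) (τ : List ℕ) → k ≤ length τ → decr (p ∷ map (spread p) (slice (λ t → nth t τ) 0 k))
              ≡ (if k ≡ᵇ 0 then true else firstLe (p ∸ 1) τ) ∧ decr (slice (λ t → nth t τ) 0 k)
      decr-p∷ zero    τ       _ = refl
      decr-p∷ (suc k) (y ∷ τ) _ = cong₂ _∧_ (trans (spread-<ᵇ-p p y) (cong (suc y <ᵇ_) (sym (m+[n∸m]≡n 1≤p))))
                                            (decr-map (spread p) mono (y ∷ slice (λ t → nth t (y ∷ τ)) 1 k))

    decr-take-l₁ : decr (take l₁ σ) ≡ decr (slice h 0 l₁)
    decr-take-l₁ = cong decr take-l₁

  -- Decreasing blocks are unimodal, so the decrease conditions absorb the first-block unimodality.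
  private
    absorb : (i u R u′ h d : Bool) → (h ∧ d ≡ true → u ≡ true) → (d ≡ true → u′ ≡ true) →
             i ∧ (u ∧ R) ∧ (h ∧ d) ≡ i ∧ (u′ ∧ R) ∧ (h ∧ d)
    absorb i u R u′ true  true  hd⇒u d⇒u′ rewrite hd⇒u refl | d⇒u′ refl = refl
    absorb i u R u′ true  false _    _    rewrite ∧-zeroʳ (u ∧ R) | ∧-zeroʳ (u′ ∧ R) = refl
    absorb i u R u′ false d     _    _    rewrite ∧-zeroʳ (u ∧ R) | ∧-zeroʳ (u′ ∧ R) = refl

  isDWithHead-insertCycle : (σ : List ℕ) → IsWord n σ → isDWithHead (insertCycle σ) ≡ isDResidue σ
  isDWithHead-insertCycle σ σ-word = begin
    isDWithHead (insertCycle σ)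
      ≡⟨ cong₂ _∧_ (isInvolution-insertCycle σ σ-word)
           (cong₂ _∧_ (lamUnimodal-insertCycle σ σ-word)
             (cong₂ _∧_ (trans (cong (_≡ᵇ p) (nth-insertCycle σ 0 (s≤s z≤n))) (≡ᵇ-refl p))
               (decr-firstBlock-insertCycle σ σ-word))) ⟩
    isInvolution σ ∧ (unimodal firstBlock ∧ laterBlocksUnimodal σ σ-word) ∧ (headBelow σ ∧ decr (take l₁ σ))
      ≡⟨ absorb (isInvolution σ) _ (laterBlocksUnimodal σ σ-word) _ (headBelow σ) (decr (take l₁ σ))
           (λ e → decr⇒unimodal firstBlock (trans (cong decr (sym take-firstBlock)) (trans (decr-firstBlock-insertCycle σ σ-word) e)))
           (λ e → decr⇒unimodal (slice (λ t → nth t σ) 0 l₁) (trans (sym (decr-take-l₁ σ σ-word)) e)) ⟩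
    isInvolution σ ∧ (unimodal (slice (λ t → nth t σ) 0 l₁) ∧ laterBlocksUnimodal σ σ-word) ∧ (headBelow σ ∧ decr (take l₁ σ))
      ≡⟨ cong (λ z → isInvolution σ ∧ z ∧ (headBelow σ ∧ decr (take l₁ σ))) (sym (lamUnimodal-residue σ σ-word)) ⟩
    isDResidue σ ∎
    where
    open ≡-Reasoning
    firstBlock : List ℕ
    firstBlock = slice (withCycle σ) 0 (suc l₁)
    take-firstBlock : take (suc l₁) (insertCycle σ) ≡ firstBlock
    take-firstBlock = take-slice (withCycle σ) 0 (suc l₁) N (s≤s (≤-trans (m≤m+n l₁ _) (n≤1+n n)))

  count-isDWithHead : count isDWithHead (allWords N) ≡ count isDResidue (allWords n)
  count-isDWithHead = count-allWords-bijection N n isDWithHead isDResidue deleteCycle insertCycle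
    (λ {π} π-word π-ok →
      let π-inv , π₀≡p = involution-with-head π π-ok
          σ-word  = IsWord-deleteCycle π π-word π-inv π₀≡p
          ins-del = insertCycle-deleteCycle π π-word π-inv π₀≡p
      in σ-word , trans (sym (isDWithHead-insertCycle _ σ-word)) (trans (cong isDWithHead ins-del) π-ok) , ins-del)
    (λ {σ} σ-word σ-ok →
      IsWord-insertCycle σ σ-word , trans (isDWithHead-insertCycle σ σ-word) σ-ok , deleteCycle-insertCycle σ σ-word)
    where
    involution-with-head : (π : List ℕ) → isDWithHead π ≡ true → isInvolution π ≡ true × nth 0 π ≡ p
    involution-with-head π π-ok with isInvolution π | lamUnimodal lam π | nth 0 π ≡ᵇ p in e | decr (take (suc l₁) π)
    ... | true | true | true | true = refl , ≡ᵇ⇒≡ _ p (≡true⇒T e)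

count-isDResidue≡countD : (k lᵢ : ℕ) (α β : List ℕ) (p : ℕ) (p-end : (p ≡ suc (suc k) + sum α) ⊎ (p ≡ suc (suc k) + sum α + lᵢ))
  (j : ℕ) (γ : List ℕ) → (∀ σ → lamUnimodal (α ++ lᵢ ∷ β) σ ≡ lamUnimodal γ σ) → suc k + sum γ ≡ TwoCycle.n (suc k) lᵢ α β p p-end →
  p ∸ 1 ≡ sum (take j (suc k ∷ γ)) →
  count (TwoCycle.isDResidue (suc k) lᵢ α β p p-end) (allWords (TwoCycle.n (suc k) lᵢ α β p p-end)) ≡ countD j (suc k ∷ γ)
count-isDResidue≡countD k lᵢ α β p p-end j γ same-blocks sum-γ head-bound = sym (begin
  countD j (suc k ∷ γ)                                 ≡⟨ countD≡count-isD j (suc k ∷ γ) ⟩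
  count (isD j (suc k ∷ γ)) (allWords (suc k + sum γ)) ≡⟨ cong (count (isD j (suc k ∷ γ)) ∘ allWords) sum-γ ⟩
  count (isD j (suc k ∷ γ)) (allWords n)               ≡⟨ count-allWords-cong n (λ σ _ →
      cong₂ (λ u s → isInvolution σ ∧ (unimodal (take (suc k) σ) ∧ u) ∧ firstLe s σ ∧ decr (take (suc k) σ))
            (sym (same-blocks (drop (suc k) σ))) (sym head-bound)) ⟩
  count isDResidue (allWords n)                        ∎)
  where
  open ≡-Reasoning
  open TwoCycle (suc k) lᵢ α β p p-end using (n; isDResidue)

count-isDResidue≡countI : (lᵢ : ℕ) (α β : List ℕ) (p : ℕ) (p-end : (p ≡ suc zero + sum α) ⊎ (p ≡ suc zero + sum α + lᵢ))
  (γ : List ℕ) → (∀ σ → lamUnimodal (α ++ lᵢ ∷ β) σ ≡ lamUnimodal γ σ) → sum γ ≡ TwoCycle.n 0 lᵢ α β p p-end →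
  count (TwoCycle.isDResidue 0 lᵢ α β p p-end) (allWords (TwoCycle.n 0 lᵢ α β p p-end)) ≡ countI γ
count-isDResidue≡countI lᵢ α β p p-end γ same-blocks sum-γ = sym (begin
  countI γ                            ≡⟨ countI≡count-isI γ ⟩
  count (isI γ) (allWords (sum γ))    ≡⟨ cong (count (isI γ) ∘ allWords) sum-γ ⟩
  count (isI γ) (allWords n)          ≡⟨ count-allWords-cong n (λ σ _ →
      trans (cong (isInvolution σ ∧_) (sym (same-blocks σ))) (cong (isInvolution σ ∧_) (sym (∧-identityʳ _)))) ⟩
  count isDResidue (allWords n)       ∎)
  where
  open ≡-Reasoning
  open TwoCycle 0 lᵢ α β p p-end using (n; isDResidue)

-- Splitting off the i-th block

take-length-++ : (α r : List ℕ) → take (length α) (α ++ r) ≡ α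
take-length-++ []      r = refl
take-length-++ (y ∷ α) r = cong (y ∷_) (take-length-++ α r)

sum-take-length : (l : ℕ) (α r : List ℕ) → sum (take (length α + 1) (l ∷ α ++ r)) ≡ l + sum α
sum-take-length l α r rewrite +-comm (length α) 1 = cong (λ z → l + sum z) (take-length-++ α r)

take-suc-length-++ : (α : List ℕ) (x : ℕ) (r : List ℕ) → take (suc (length α)) (α ++ x ∷ r) ≡ α ++ x ∷ []
take-suc-length-++ []      x r = refl
take-suc-length-++ (y ∷ α) x r = cong (y ∷_) (take-suc-length-++ α x r)

sum-take-suc-length : (l : ℕ) (α : List ℕ) (x : ℕ) (r : List ℕ) →
                      sum (take (length α + 2) (l ∷ α ++ x ∷ r)) ≡ l + (sum α + x)
sum-take-suc-length l α x r rewrite +-comm (length α) 2 =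
  cong (l +_) (trans (cong sum (take-suc-length-++ α x r)) (trans (sum-++ α (x ∷ [])) (cong (sum α +_) (+-identityʳ x))))

-- λ = (l₁ + 1, α, lᵢ + 1, β); block i of λ (0-based positions start … start + lᵢ) follows α.
module BlockSplit (l₁ lᵢ : ℕ) (α β : List ℕ) where

  module AtStart = TwoCycle l₁ lᵢ α β (suc l₁ + sum α) (inj₁ refl)
  module AtEnd   = TwoCycle l₁ lᵢ α β (suc l₁ + sum α + lᵢ) (inj₂ refl)
  open AtStart using (n; N; start; lam; sum-lam)

  #α : ℕ
  #α = length α

  sum-before-block : sum (take (#α + 1) lam) ≡ start
  sum-before-block = sum-take-length (suc l₁) α (suc lᵢ ∷ β)

  sum-through-block : sum (take (#α + 2) lam) ≡ start + suc lᵢ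
  sum-through-block = trans (sum-take-suc-length (suc l₁) α (suc lᵢ) β) (cong suc (sym (+-assoc l₁ (sum α) (suc lᵢ))))

  head-at-block-end : (π : List ℕ) → IsWord N π → isInvolution π ≡ true → lamUnimodal lam π ≡ true →
                      start ≤ nth 0 π → nth 0 π < start + suc lᵢ → nth 0 π ≡ start ⊎ nth 0 π ≡ start + lᵢ
  head-at-block-end π π-word π-inv π-unimodal start≤ <end with unimodal-0⇒end block q block-unimodal block-q≡0 q<len
    where
    h : ℕ → ℕ
    h t = nth t π
    block : List ℕ
    block = slice h start (suc lᵢ)
    q : ℕ
    q = nth 0 π ∸ start
    start+q : start + q ≡ nth 0 π
    start+q = m+[n∸m]≡n start≤
    q<len : q < length block
    q<len = subst (q <_) (sym (length-slice h start (suc lᵢ)))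
                  (+-cancelˡ-< start q (suc lᵢ) (subst (_< start + suc lᵢ) (sym start+q) <end))
    block-q≡0 : nth q block ≡ 0
    block-q≡0 = trans (nth-slice h start (suc lᵢ) q (subst (q <_) (length-slice h start (suc lᵢ)) q<len))
                  (trans (cong h start+q) (isInvolution⇒ π π-inv 0 (subst (0 <_) (sym (proj₁ π-word)) (s≤s z≤n))))
    block-unimodal : unimodal block ≡ true
    block-unimodal =
      let blocks = trans (sym (lamUnimodal≡unimodalBlocks lam π (≤-reflexive (trans sum-lam (sym (proj₁ π-word)))))) π-unimodal
          after-α = trans (sym (unimodalBlocks-++ h (suc l₁) α (suc lᵢ ∷ β))) (∧-conicalʳ _ _ blocks)
      in ∧-conicalˡ (unimodal block) _ (∧-conicalʳ (unimodalBlocks h (suc l₁) α) _ after-α)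
  ... | inj₁ q≡0    = inj₁ (trans (sym (m+[n∸m]≡n start≤)) (trans (cong (start +_) q≡0) (+-identityʳ start)))
  ... | inj₂ q-last = inj₂ (trans (sym (m+[n∸m]≡n start≤))
                                  (cong (start +_) (suc-injective (trans q-last (length-slice _ start (suc lᵢ))))))

  private
    split-below : (I U f₂ D f₁ : Bool) → (f₁ ≡ true → f₂ ≡ true) → (I ∧ U ∧ f₂ ∧ D) ∧ f₁ ≡ I ∧ U ∧ f₁ ∧ D
    split-below I U f₂ D true  f₁⇒f₂ rewrite f₁⇒f₂ refl = ∧-identityʳ _
    split-below I U f₂ D false _     = trans (∧-zeroʳ _) (sym (∧-false-third I U D))

    split-at-end : (I U f₂ D f₁ e : Bool) → (e ≡ true → f₂ ≡ true × f₁ ≡ false) →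
                   ((I ∧ U ∧ f₂ ∧ D) ∧ not f₁) ∧ e ≡ I ∧ U ∧ e ∧ D
    split-at-end I U f₂ D f₁ true  e⇒ with e⇒ refl
    ... | refl , refl = trans (∧-identityʳ _) (∧-identityʳ _)
    split-at-end I U f₂ D f₁ false _  = trans (∧-zeroʳ _) (sym (∧-false-third I U D))

    split-at-start : (I U f₂ D f₁ e e′ c : Bool) → (e′ ≡ true → f₂ ≡ true × f₁ ≡ false × not e ≡ c) →
                     (I ≡ true → U ≡ true → f₂ ≡ true → D ≡ true → f₁ ≡ false → e ≡ false → e′ ≡ true) →
                     ((I ∧ U ∧ f₂ ∧ D) ∧ not f₁) ∧ not e ≡ (I ∧ U ∧ e′ ∧ D) ∧ c
    split-at-start I     U     f₂    D     f₁    e     true  c e′⇒ _ with e′⇒ refl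
    ... | refl , refl , refl = cong (_∧ not e) (∧-identityʳ _)
    split-at-start false U     f₂    D     f₁    e     false c _ _ = refl
    split-at-start true  false f₂    D     f₁    e     false c _ _ = refl
    split-at-start true  true  false D     f₁    e     false c _ _ = refl
    split-at-start true  true  true  false f₁    e     false c _ _ = refl
    split-at-start true  true  true  true  true  e     false c _ _ = refl
    split-at-start true  true  true  true  false true  false c _ _ = refl
    split-at-start true  true  true  true  false false false c _ forced with forced refl refl refl refl refl refl
    ... | ()

  below : List ℕ → Bool
  below = firstLe (sum (take (#α + 1) lam))

  atEnd : List ℕ → Bool
  atEnd π = nth 0 π ≡ᵇ (start + lᵢ)

  below-∷ : (x₀ : ℕ) (r : List ℕ) → below (x₀ ∷ r) ≡ (x₀ <ᵇ start)
  below-∷ x₀ r = cong (x₀ <ᵇ_) sum-before-block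

  within-∷ : (x₀ : ℕ) (r : List ℕ) → firstLe (sum (take (#α + 2) lam)) (x₀ ∷ r) ≡ (x₀ <ᵇ start + suc lᵢ)
  within-∷ x₀ r = cong (x₀ <ᵇ_) sum-through-block

  start<block-end : start < start + suc lᵢ
  start<block-end = m<m+n start (s≤s z≤n)

  end<block-end : start + lᵢ < start + suc lᵢ
  end<block-end = +-monoʳ-< start (n<1+n lᵢ)

  within : List ℕ → Bool
  within = firstLe (sum (take (#α + 2) lam))

  firstDecreasing : List ℕ → Bool
  firstDecreasing π = decr (take (suc l₁) π)

  below⇒within : (π : List ℕ) → below π ≡ true → within π ≡ true
  below⇒within (x₀ ∷ r) b = trans (within-∷ x₀ r)
    (<ᵇ≡true (<-≤-trans (<ᵇ⇒< x₀ start (≡true⇒T (trans (sym (below-∷ x₀ r)) b))) (<⇒≤ start<block-end)))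

  isD-below : (π : List ℕ) → isD (#α + 2) lam π ∧ below π ≡ isD (#α + 1) lam π
  isD-below π = split-below (isInvolution π) (lamUnimodal lam π) (within π) (firstDecreasing π) (below π) (below⇒within π)

  isD-atEnd : (π : List ℕ) → IsWord N π → (isD (#α + 2) lam π ∧ not (below π)) ∧ atEnd π ≡ AtEnd.isDWithHead π
  isD-atEnd π@(x₀ ∷ r) _ =
    split-at-end (isInvolution π) (lamUnimodal lam π) (within π) (firstDecreasing π) (below π) (atEnd π) λ e →
      let x₀≡end = ≡ᵇ⇒≡ x₀ _ (≡true⇒T e) in
      trans (within-∷ x₀ r) (<ᵇ≡true (subst (_< start + suc lᵢ) (sym x₀≡end) end<block-end)) ,
      trans (below-∷ x₀ r) (<ᵇ≡false (subst (start ≤_) (sym x₀≡end) (m≤m+n start lᵢ)))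

  isD-atStart : (π : List ℕ) → IsWord N π →
                (isD (#α + 2) lam π ∧ not (below π)) ∧ not (atEnd π) ≡ AtStart.isDWithHead π ∧ not (lᵢ ≡ᵇ 0)
  isD-atStart π@(x₀ ∷ r) π-word =
    split-at-start (isInvolution π) (lamUnimodal lam π) (within π) (firstDecreasing π) (below π) (atEnd π)
                   (x₀ ≡ᵇ start) (not (lᵢ ≡ᵇ 0))
      (λ e′ → let x₀≡start = ≡ᵇ⇒≡ x₀ _ (≡true⇒T e′) in
        trans (within-∷ x₀ r) (<ᵇ≡true (subst (_< start + suc lᵢ) (sym x₀≡start) start<block-end)) ,
        trans (below-∷ x₀ r) (<ᵇ≡false (≤-reflexive (sym x₀≡start))) ,
        cong not (trans (cong (_≡ᵇ start + lᵢ) x₀≡start) (≡ᵇ-+ start lᵢ)))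
      λ π-inv π-unimodal x₀-within _ not-below not-end →
        case head-at-block-end π π-word π-inv π-unimodal
               (<ᵇ≡false⇒≥ (trans (sym (below-∷ x₀ r)) not-below))
               (<ᵇ⇒< x₀ _ (≡true⇒T (trans (sym (within-∷ x₀ r)) x₀-within))) of λ where
          (inj₁ x₀≡start) → T⇒≡true (≡⇒≡ᵇ x₀ start x₀≡start)
          (inj₂ x₀≡end)   → ⊥-elim (subst T not-end (≡⇒≡ᵇ x₀ _ x₀≡end))

  residues : ℕ
  residues = count AtEnd.isDResidue (allWords n) + (if not (lᵢ ≡ᵇ 0) then count AtStart.isDResidue (allWords n) else 0)

  countD-i+2 : countD (#α + 2) lam ≡ countD (#α + 1) lam + residues
  countD-i+2 = begin
    countD (#α + 2) lam
      ≡⟨ countD-on-words (#α + 2) ⟩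
    count D₂ W
      ≡⟨ count-split D₂ below W ⟩
    count (λ π → D₂ π ∧ below π) W + count D₂′ W
      ≡⟨ cong₂ _+_ (count-cong W λ {π} _ → isD-below π) (count-split D₂′ atEnd W) ⟩
    count (isD (#α + 1) lam) W + (count (λ π → D₂′ π ∧ atEnd π) W + count (λ π → D₂′ π ∧ not (atEnd π)) W)
      ≡⟨ cong₂ _+_ (sym (countD-on-words (#α + 1))) (cong₂ _+_ (count-allWords-cong N isD-atEnd) (count-allWords-cong N isD-atStart)) ⟩
    countD (#α + 1) lam + (count AtEnd.isDWithHead W + count (λ π → AtStart.isDWithHead π ∧ not (lᵢ ≡ᵇ 0)) W)
      ≡⟨ cong (countD (#α + 1) lam +_) (cong₂ _+_ AtEnd.count-isDWithHead at-start) ⟩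
    countD (#α + 1) lam + residues
      ∎
    where
    open ≡-Reasoning
    W : List (List ℕ)
    W = allWords N
    D₂ D₂′ : List ℕ → Bool
    D₂ = isD (#α + 2) lam
    D₂′ π = D₂ π ∧ not (below π)
    countD-on-words : (j : ℕ) → countD j lam ≡ count (isD j lam) W
    countD-on-words j = trans (countD≡count-isD j lam) (cong (count (isD j lam) ∘ allWords) sum-lam)
    at-start : count (λ π → AtStart.isDWithHead π ∧ not (lᵢ ≡ᵇ 0)) W
             ≡ (if not (lᵢ ≡ᵇ 0) then count AtStart.isDResidue (allWords n) else 0)
    at-start = trans (count-∧-const AtStart.isDWithHead _ W) (if-cong {c = not (lᵢ ≡ᵇ 0)} refl AtStart.count-isDWithHead refl)

positive : List ℕ → Bool
positive = allᵇ (λ e → 1 ≤ᵇ e)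

Dcoeff : ℕ → List ℕ → ℕ
Dcoeff i lam = if positive lam then countD i lam else 0

Lcoeff : List ℕ → ℕ
Lcoeff lam = if positive lam then countI lam else 0

positive-++ : (xs ys : List ℕ) → positive (xs ++ ys) ≡ positive xs ∧ positive ys
positive-++ []       ys = refl
positive-++ (x ∷ xs) ys = trans (cong ((1 ≤ᵇ x) ∧_) (positive-++ xs ys)) (sym (∧-assoc (1 ≤ᵇ x) (positive xs) (positive ys)))

positive-0 : (xs ys : List ℕ) → positive (xs ++ 0 ∷ ys) ≡ false
positive-0 xs ys = trans (positive-++ xs (0 ∷ ys)) (∧-zeroʳ (positive xs))

positive-interleave : (u v α β : List ℕ) → positive α ∧ positive β ≡ false → positive (u ++ α ++ v ++ β) ≡ false
positive-interleave u v α β e rewrite positive-++ u (α ++ v ++ β) | positive-++ α (v ++ β) | positive-++ v β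
  with positive α | positive β
... | false | _     = ∧-zeroʳ (positive u)
... | true  | false = trans (cong (positive u ∧_) (∧-zeroʳ (positive v))) (∧-zeroʳ (positive u))
... | true  | true  with e
...   | ()

-- Coefficient at ν = (l₁, α, lᵢ, β) of D_{i-1} + D_{i-1}(x̂ᵢ) + L(x̂₁, x̂ᵢ) + 2 L(x̂₁) + D_i, where #α = |α| = i − 2.
residueCoeff : (#α l₁ lᵢ : ℕ) (α β : List ℕ) → ℕ
residueCoeff #α l₁ lᵢ α β =
  (Dcoeff (#α + 1) (l₁ ∷ α ++ lᵢ ∷ β)
   + ((if lᵢ ≡ᵇ 0 then Dcoeff (#α + 1) (l₁ ∷ α ++ β) else 0)
   + ((if l₁ ≡ᵇ 0 then (if lᵢ ≡ᵇ 0 then Lcoeff (α ++ β) else 0) else 0)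
   + 2 * (if l₁ ≡ᵇ 0 then Lcoeff (α ++ lᵢ ∷ β) else 0))))
  + Dcoeff (#α + 2) (l₁ ∷ α ++ lᵢ ∷ β)

residueCoeff-vanishes : (#α l₁ lᵢ : ℕ) (α β : List ℕ) → positive α ∧ positive β ≡ false → residueCoeff #α l₁ lᵢ α β ≡ 0
residueCoeff-vanishes #α l₁ lᵢ α β e
  rewrite positive-interleave (l₁ ∷ []) (lᵢ ∷ []) α β e | positive-interleave (l₁ ∷ []) [] α β e
        | positive-interleave [] [] α β e | positive-interleave [] (lᵢ ∷ []) α β e
  with l₁ ≡ᵇ 0 | lᵢ ≡ᵇ 0
... | true  | true  = refl
... | true  | false = refl
... | false | true  = refl
... | false | false = refl

residues≡residueCoeff : (l₁ lᵢ : ℕ) (α β : List ℕ) → positive α ≡ true → positive β ≡ true →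
                        BlockSplit.residues l₁ lᵢ α β ≡ residueCoeff (length α) l₁ lᵢ α β
residues≡residueCoeff (suc k) (suc t) α β pα pβ rewrite positive-++ α (suc t ∷ β) | pα | pβ =
  trans (+-comm (count AtEnd.isDResidue (allWords AtEnd.n)) _) (cong₂ _+_
    (trans (count-isDResidue≡countD k (suc t) α β _ (inj₁ refl) (length α + 1) (α ++ suc t ∷ β) (λ _ → refl)
              (cong (suc k +_) (sum-++ α (suc t ∷ β))) (sym (sum-take-length (suc k) α (suc t ∷ β))))
           (sym (+-identityʳ _)))
    (count-isDResidue≡countD k (suc t) α β _ (inj₂ refl) (length α + 2) (α ++ suc t ∷ β) (λ _ → refl)
       (cong (suc k +_) (sum-++ α (suc t ∷ β)))
       (trans (+-assoc (suc k) (sum α) (suc t)) (sym (sum-take-suc-length (suc k) α (suc t) β)))))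
  where open BlockSplit (suc k) (suc t) α β using (module AtEnd)
residues≡residueCoeff (suc k) zero α β pα pβ
  rewrite positive-0 (suc k ∷ α) β | positive-++ α β | pα | pβ =
  cong (_+ 0) (trans (count-isDResidue≡countD k 0 α β _ (inj₂ refl) (length α + 1) (α ++ β) (lamUnimodal-drop0 α β)
                        (cong (suc k +_) (sum-++ α β)) (trans (+-identityʳ _) (sym (sum-take-length (suc k) α β))))
                     (sym (+-identityʳ _)))
residues≡residueCoeff zero (suc t) α β pα pβ rewrite positive-++ α (suc t ∷ β) | pα | pβ =
  trans (cong₂ _+_ (count-isDResidue≡countI (suc t) α β _ (inj₂ refl) (α ++ suc t ∷ β) (λ _ → refl) (sum-++ α (suc t ∷ β)))
                   (count-isDResidue≡countI (suc t) α β _ (inj₁ refl) (α ++ suc t ∷ β) (λ _ → refl) (sum-++ α (suc t ∷ β))))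
        (sym (trans (+-identityʳ _) (cong (countI (α ++ suc t ∷ β) +_) (+-identityʳ _))))
residues≡residueCoeff zero zero α β pα pβ rewrite positive-0 α β | positive-++ α β | pα | pβ =
  cong (_+ 0) (trans (count-isDResidue≡countI 0 α β _ (inj₂ refl) (α ++ β) (lamUnimodal-drop0 α β) (sum-++ α β))
                     (sym (+-identityʳ _)))

Dcoeff-step : (x y : ℕ) (α β : List ℕ) {#α : ℕ} → length α ≡ #α →
  Dcoeff (#α + 2) (x ∷ α ++ y ∷ β)
    ≡ Dcoeff (#α + 1) (x ∷ α ++ y ∷ β) + (if (1 ≤ᵇ x) ∧ (1 ≤ᵇ y) then residueCoeff #α (x ∸ 1) (y ∸ 1) α β else 0)
Dcoeff-step zero      y          α β refl = refl
Dcoeff-step (suc l₁) zero       α β refl rewrite positive-0 (suc l₁ ∷ α) β = refl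
Dcoeff-step (suc l₁) (suc lᵢ) α β refl with positive α ∧ positive β in αβ-positive
... | true  rewrite positive-++ α (suc lᵢ ∷ β) | αβ-positive =
  trans (BlockSplit.countD-i+2 l₁ lᵢ α β)
        (cong (countD (length α + 1) (suc l₁ ∷ α ++ suc lᵢ ∷ β) +_)
              (residues≡residueCoeff l₁ lᵢ α β (∧-conicalˡ _ _ αβ-positive) (∧-conicalʳ _ _ αβ-positive)))
... | false rewrite positive-++ α (suc lᵢ ∷ β) | αβ-positive =
  sym (residueCoeff-vanishes (length α) l₁ lᵢ α β αβ-positive)

map-applyUpTo : (g f : ℕ → ℕ) (n : ℕ) → map g (applyUpTo f n) ≡ applyUpTo (g ∘ f) n
map-applyUpTo g f zero    = refl
map-applyUpTo g f (suc n) = cong (g (f 0) ∷_) (map-applyUpTo g (f ∘ suc) n)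

applyUpTo-cong : {f g : ℕ → ℕ} (n : ℕ) → (∀ t → f t ≡ g t) → applyUpTo f n ≡ applyUpTo g n
applyUpTo-cong zero    e = refl
applyUpTo-cong (suc n) e = cong₂ _∷_ (e 0) (applyUpTo-cong n (e ∘ suc))

sum-applyUpTo-0 : (f : ℕ → ℕ) (n : ℕ) → (∀ t → f t ≡ 0) → sum (applyUpTo f n) ≡ 0
sum-applyUpTo-0 f zero    _  = refl
sum-applyUpTo-0 f (suc n) f≡0 rewrite f≡0 0 = sum-applyUpTo-0 (f ∘ suc) n (f≡0 ∘ suc)

module _ {m : ℕ} (j : Fin (suc m)) (G : Series (suc (suc m))) where

  private
    shifted : ℕ → Vec ℕ (suc (suc m)) → ℕ
    shifted t = shiftCoeff fz (fs j) t G

  divOneMinus-∷ : (x : ℕ) (τ : Vec ℕ (suc m)) →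
                  divOneMinus fz (fs j) G (x V.∷ τ) ≡ G (x V.∷ τ) + sum (applyUpTo (λ t → shifted (suc t) (x V.∷ τ)) x)
  divOneMinus-∷ x τ = cong₂ _+_ (cong (G ∘ (x V.∷_)) (V.updateAt-id j τ)) (cong sum (map-applyUpTo (λ t → shifted t (x V.∷ τ)) suc x))

  shifted-edge : (x : ℕ) (τ : Vec ℕ (suc m)) → lookup τ j ≡ 0 → sum (applyUpTo (λ t → shifted (suc t) (suc x V.∷ τ)) (suc x)) ≡ 0
  shifted-edge x τ τⱼ≡0 = sum-applyUpTo-0 _ (suc x) λ t → trans
    (cong (λ z → if (suc t ≤ᵇ suc x) ∧ (suc t ≤ᵇ z) then G ((suc x ∸ suc t) V.∷ updateAt τ j (_∸ suc t)) else 0) τⱼ≡0)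
    (if-cong {c = (suc t ≤ᵇ suc x) ∧ false} (∧-zeroʳ _) refl refl)

  shifted-diagonal : (x y : ℕ) (τ : Vec ℕ (suc m)) → lookup τ j ≡ suc y →
                     sum (applyUpTo (λ t → shifted (suc t) (suc x V.∷ τ)) (suc x)) ≡ divOneMinus fz (fs j) G (x V.∷ updateAt τ j (_∸ 1))
  shifted-diagonal x y τ τⱼ≡1+y =
    trans (cong sum (applyUpTo-cong (suc x) step)) (sym (cong sum (map-applyUpTo (λ t → shifted t (x V.∷ τ′)) (λ t → t) (suc x))))
    where
    τ′ : Vec ℕ (suc m)
    τ′ = updateAt τ j (_∸ 1)
    τ′ⱼ≡y : lookup τ′ j ≡ y
    τ′ⱼ≡y = trans (V.lookup∘updateAt j τ) (cong (_∸ 1) τⱼ≡1+y)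
    step : (t : ℕ) → shifted (suc t) (suc x V.∷ τ) ≡ shifted t (x V.∷ τ′)
    step t = if-cong
      (cong₂ _∧_ (≤ᵇ-suc t x) (trans (cong (suc t ≤ᵇ_) τⱼ≡1+y) (trans (≤ᵇ-suc t y) (cong (t ≤ᵇ_) (sym τ′ⱼ≡y)))))
      (cong (λ v → G ((x ∸ t) V.∷ v)) (sym (V.updateAt-updateAt-local j τ (∸-+-assoc (lookup τ j) 1 t))))
      refl

  module _ (F : Series (suc (suc m))) (F≡ : ∀ μ → F μ ≡ G μ + mulMono fz (fs j) F μ) where

    unfold : (x : ℕ) (τ : Vec ℕ (suc m)) → F (x V.∷ τ) ≡ divOneMinus fz (fs j) G (x V.∷ τ)
    unfold zero τ = begin
      F (0 V.∷ τ)                                    ≡⟨ F≡ (0 V.∷ τ) ⟩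
      G (0 V.∷ τ) + 0                                ≡⟨ sym (divOneMinus-∷ 0 τ) ⟩
      divOneMinus fz (fs j) G (0 V.∷ τ)              ∎
      where open ≡-Reasoning
    unfold (suc x) τ = diagonal (lookup τ j) refl
      where
      open ≡-Reasoning
      τ′ : Vec ℕ (suc m)
      τ′ = updateAt τ j (_∸ 1)
      mulMono-F : (v : ℕ) → lookup τ j ≡ v → mulMono fz (fs j) F (suc x V.∷ τ) ≡ (if 1 ≤ᵇ v then F (x V.∷ τ′) else 0)
      mulMono-F v = cong (λ z → if 1 ≤ᵇ z then F (x V.∷ τ′) else 0)
      diagonal : (v : ℕ) → lookup τ j ≡ v → F (suc x V.∷ τ) ≡ divOneMinus fz (fs j) G (suc x V.∷ τ)
      diagonal zero τⱼ≡0 = begin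
        F (suc x V.∷ τ)                                        ≡⟨ F≡ (suc x V.∷ τ) ⟩
        G (suc x V.∷ τ) + mulMono fz (fs j) F (suc x V.∷ τ)    ≡⟨ cong (G (suc x V.∷ τ) +_) (mulMono-F 0 τⱼ≡0) ⟩
        G (suc x V.∷ τ) + 0                                    ≡⟨ cong (G (suc x V.∷ τ) +_) (sym (shifted-edge x τ τⱼ≡0)) ⟩
        G (suc x V.∷ τ) + sum (applyUpTo (λ t → shifted (suc t) (suc x V.∷ τ)) (suc x))
                                                               ≡⟨ sym (divOneMinus-∷ (suc x) τ) ⟩
        divOneMinus fz (fs j) G (suc x V.∷ τ)                  ∎
      diagonal (suc y) τⱼ≡1+y = begin
        F (suc x V.∷ τ)                                        ≡⟨ F≡ (suc x V.∷ τ) ⟩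
        G (suc x V.∷ τ) + mulMono fz (fs j) F (suc x V.∷ τ)    ≡⟨ cong (G (suc x V.∷ τ) +_) (mulMono-F (suc y) τⱼ≡1+y) ⟩
        G (suc x V.∷ τ) + F (x V.∷ τ′)                         ≡⟨ cong (G (suc x V.∷ τ) +_) (unfold x τ′) ⟩
        G (suc x V.∷ τ) + divOneMinus fz (fs j) G (x V.∷ τ′)   ≡⟨ cong (G (suc x V.∷ τ) +_) (sym (shifted-diagonal x y τ τⱼ≡1+y)) ⟩
        G (suc x V.∷ τ) + sum (applyUpTo (λ t → shifted (suc t) (suc x V.∷ τ)) (suc x))
                                                               ≡⟨ sym (divOneMinus-∷ (suc x) τ) ⟩
        divOneMinus fz (fs j) G (suc x V.∷ τ)                  ∎

    -- F = G + x₀xⱼ F is solved by unfolding it along the diagonal of the exponents at positions 0 and j.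
    divOneMinus-unique : F ≈ divOneMinus fz (fs j) G
    divOneMinus-unique (x V.∷ τ) = unfold x τ

before after : {m : ℕ} → Vec ℕ (suc m) → Fin (suc m) → List ℕ
before τ j = take (toℕ j) (toList τ)
after  τ j = drop (suc (toℕ j)) (toList τ)

length-before : {m : ℕ} (τ : Vec ℕ (suc m)) (j : Fin (suc m)) → length (before τ j) ≡ toℕ j
length-before (x V.∷ τ)         fz     = refl
length-before {suc m} (x V.∷ τ) (fs j) = cong suc (length-before τ j)

toList-lookup : {m : ℕ} (τ : Vec ℕ (suc m)) (j : Fin (suc m)) → toList τ ≡ before τ j ++ lookup τ j ∷ after τ j
toList-lookup (x V.∷ τ)         fz     = refl
toList-lookup {suc m} (x V.∷ τ) (fs j) = cong (x ∷_) (toList-lookup τ j)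

toList-removeAt : {m : ℕ} (τ : Vec ℕ (suc m)) (j : Fin (suc m)) → toList (removeAt τ j) ≡ before τ j ++ after τ j
toList-removeAt (x V.∷ τ)                 fz     = refl
toList-removeAt {suc m} (x V.∷ y V.∷ τ) (fs j) = cong (x ∷_) (toList-removeAt (y V.∷ τ) j)

toList-updateAt : {m : ℕ} (τ : Vec ℕ (suc m)) (j : Fin (suc m)) (f : ℕ → ℕ) →
                  toList (updateAt τ j f) ≡ before τ j ++ f (lookup τ j) ∷ after τ j
toList-updateAt (x V.∷ τ)         fz     f = refl
toList-updateAt {suc m} (x V.∷ τ) (fs j) f = cong (x ∷_) (toList-updateAt τ j f)

removeAt-suc : {m : ℕ} (x : ℕ) (τ : Vec ℕ (suc m)) (j : Fin (suc m)) → removeAt (x V.∷ τ) (fs j) ≡ x V.∷ removeAt τ j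
removeAt-suc x (y V.∷ τ) j = refl

removeAt-updateAt : {m : ℕ} (τ : Vec ℕ (suc m)) (j : Fin (suc m)) (f : ℕ → ℕ) → removeAt (updateAt τ j f) j ≡ removeAt τ j
removeAt-updateAt (x V.∷ τ)         fz     f = refl
removeAt-updateAt {suc m} (x V.∷ τ) (fs j) f =
  trans (removeAt-suc x (updateAt τ j f) j) (trans (cong (x V.∷_) (removeAt-updateAt τ j f)) (sym (removeAt-suc x τ j)))

residueSeries : (m : ℕ) (j : Fin (suc m)) → Series (suc (suc m))
residueSeries m j =
  D (suc (suc m)) (toℕ j + 1) ⊕ (hat (fs j) (D (suc m) (toℕ j + 1)) ⊕ (hat fz (hat j (L m)) ⊕ scale 2 (hat fz (L (suc m)))))

residueSeries-coeff : (m : ℕ) (j : Fin (suc m)) (x : ℕ) (τ : Vec ℕ (suc m)) →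
  let ν = (x ∸ 1) V.∷ updateAt τ j (_∸ 1) in
  residueSeries m j ν + D (suc (suc m)) (toℕ j + 2) ν ≡ residueCoeff (toℕ j) (x ∸ 1) (lookup τ j ∸ 1) (before τ j) (after τ j)
residueSeries-coeff m j x τ = cong₂ _+_
  (cong₂ _+_ (cong (Dcoeff (toℕ j + 1) ∘ ((x ∸ 1) ∷_)) updated)
    (cong₂ _+_ (if-cong lookup-updated (trans (cong (D (suc m) (toℕ j + 1)) (removeAt-suc (x ∸ 1) τ′ j))
                                                 (cong (Dcoeff (toℕ j + 1) ∘ ((x ∸ 1) ∷_)) removed)) refl)
      (cong₂ _+_ (if-cong {c = (x ∸ 1) ≡ᵇ 0} refl (if-cong lookup-updated (cong Lcoeff removed) refl) refl)
                 (cong (2 *_) (if-cong {c = (x ∸ 1) ≡ᵇ 0} refl (cong Lcoeff updated) refl)))))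
  (cong (Dcoeff (toℕ j + 2) ∘ ((x ∸ 1) ∷_)) updated)
  where
  τ′ : Vec ℕ (suc m)
  τ′ = updateAt τ j (_∸ 1)
  updated : toList τ′ ≡ before τ j ++ (lookup τ j ∸ 1) ∷ after τ j
  updated = toList-updateAt τ j (_∸ 1)
  removed : toList (removeAt τ′ j) ≡ before τ j ++ after τ j
  removed = trans (cong toList (removeAt-updateAt τ j (_∸ 1))) (toList-removeAt τ j)
  lookup-updated : (lookup τ′ j ≡ᵇ 0) ≡ ((lookup τ j ∸ 1) ≡ᵇ 0)
  lookup-updated = cong (_≡ᵇ 0) (V.lookup∘updateAt j τ)

D-fixpoint : (m : ℕ) (j : Fin (suc m)) (μ : Vec ℕ (suc (suc m))) →
  D (suc (suc m)) (toℕ j + 2) μ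
    ≡ (D (suc (suc m)) (toℕ j + 1) ⊕ mulMono fz (fs j) (residueSeries m j)) μ + mulMono fz (fs j) (D (suc (suc m)) (toℕ j + 2)) μ
D-fixpoint m j (x V.∷ τ) = begin
  Dcoeff (toℕ j + 2) (x ∷ toList τ)
    ≡⟨ cong (Dcoeff (toℕ j + 2) ∘ (x ∷_)) (toList-lookup τ j) ⟩
  Dcoeff (toℕ j + 2) (x ∷ α ++ y ∷ β)
    ≡⟨ Dcoeff-step x y α β (length-before τ j) ⟩
  Dcoeff (toℕ j + 1) (x ∷ α ++ y ∷ β) + (if c then residueCoeff (toℕ j) (x ∸ 1) (y ∸ 1) α β else 0)
    ≡⟨ cong₂ _+_ (cong (Dcoeff (toℕ j + 1) ∘ (x ∷_)) (sym (toList-lookup τ j)))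
                 (trans (if-cong {c = c} refl (sym (residueSeries-coeff m j x τ)) refl) (if-+ c _ _)) ⟩
  Dcoeff (toℕ j + 1) (x ∷ toList τ) + ((if c then residueSeries m j ν else 0) + (if c then D (suc (suc m)) (toℕ j + 2) ν else 0))
    ≡⟨ sym (+-assoc (Dcoeff (toℕ j + 1) (x ∷ toList τ)) _ _) ⟩
  (Dcoeff (toℕ j + 1) (x ∷ toList τ) + (if c then residueSeries m j ν else 0)) + (if c then D (suc (suc m)) (toℕ j + 2) ν else 0) ∎
  where
  open ≡-Reasoning
  α β : List ℕ
  α = before τ j
  β = after τ j
  y : ℕ
  y = lookup τ j
  c : Bool
  c = (1 ≤ᵇ x) ∧ (1 ≤ᵇ y)
  ν : Vec ℕ (suc (suc m))
  ν = (x ∸ 1) V.∷ updateAt τ j (_∸ 1)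

lemma4p6 : (m : ℕ) (j : Fin (suc m)) →
    D (suc (suc m)) (toℕ j + 2)
      ≈ divOneMinus fz (fs j)
          (D (suc (suc m)) (toℕ j + 1)
           ⊕ mulMono fz (fs j)
               (D (suc (suc m)) (toℕ j + 1)
                ⊕ (hat (fs j) (D (suc m) (toℕ j + 1))
                ⊕ (hat fz (hat j (L m))
                ⊕ scale 2 (hat fz (L (suc m)))))))
lemma4p6 m j = divOneMinus-unique j _ (D (suc (suc m)) (toℕ j + 2)) (D-fixpoint m j)
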